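{- Let $\widetilde{\Sigma}$ be a 2-stack call-return alphabet and let $w\in\Delta^+$ be circular (with respect to $\widetilde{\Sigma}$). Then for all $k\ge2$, $w^k$ is not circular.
   Context: For $n\in\mathbb{N}$ let $[n]=\{1,\dots,n\}$. A 2-stack call-return alphabet is $\widetilde{\Sigma}=\langle\{(\Sigma_c^1,\Sigma_r^1),(\Sigma_c^2,\Sigma_r^2)\},\Sigma_{int}\rangle$ of pairwise disjoint finite sets; $\Sigma=\Sigma_c^1\cup\Sigma_c^2\cup\Sigma_r^1\cup\Sigma_r^2\cup\Sigma_{int}$. A string is $s$-well formed if generated by $A::=aAb\mid AA\mid\varepsilon\mid c$ with $a\in\Sigma_c^s$, $b\in\Sigma_r^s$, $c\in\Sigma\setminus(\Sigma_c^s\cup\Sigma_r^s)$. A nested word over $\widetilde{\Sigma}$ is $([n],\lessdot,\mu,\lambda)$ with $n\ge1$, $\lessdot=\{(i,i+1)\mid i\in[n-1]\}$, $\lambda:[n]\to\Sigma$, $\mu=\mu^1\cup\mu^2$ with $(i,j)\in\mu^s$ iff $i<j$, $\lambda(i)\in\Sigma_c^s$, $\lambda(j)\in\Sigma_r^s$ and $\lambda(i+1)\dots\lambda(j-1)$ $s$-well formed; $\mathbb{NW}(\widetilde{\Sigma})$ is the set of nested words. $\mu$ is a partial injection; write $\mu(i)=j$, $\mu^{ -1}(j)=i$ for $(i,j)\in\mu$. Let $\Delta=\{\rightarrow,\leftarrow,+_1,-_1,+_2,-_2\}$ be a set of six directions. For a nested word $W=([n],\lessdot,\mu,\lambda)$,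 $i,j\in[n]$ and $w=e_1\dots e_m\in\Delta^*$, write $i\hookrightarrow^w_W j$ if there are $i_0,\dots,i_m\in[n]$ with $i_0,\dots,i_{m-1}$ pairwise distinct, $i_m\notin\{i_1,\dots,i_{m-1}\}$, $i_0=i$, $i_m=j$, and for every $k\in\{0,\dots,m-1\}$: if $e_{k+1}=\rightarrow$ then $i_{k+1}=i_k+1$; if $e_{k+1}=\leftarrow$ then $i_{k+1}=i_k-1$; if $e_{k+1}=+_s$ then $\lambda(i_k)\in\Sigma_c^s$, $\mu(i_k)$ is defined and $i_{k+1}=\mu(i_k)$; if $e_{k+1}=-_s$ then $\lambda(i_k)\in\Sigma_r^s$, $\mu^{ -1}(i_k)$ is defined and $i_{k+1}=\mu^{ -1}(i_k)$. A string $w\in\Delta^+$ is circular if $i\hookrightarrow^w_W i$ for some $W\in\mathbb{NW}(\widetilde{\Sigma})$ and some position $i$ of $W$. -}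

module Defs where

open import Data.Nat using (ℕ; zero; suc; _<_; _≤_; _∸_)
open import Data.Fin using (Fin; zero; suc; inject₁; fromℕ; toℕ)
open import Data.List using (List; []; _∷_; _++_; [_]; length; take; drop; lookup)
open import Data.Maybe using (Maybe; just; nothing)
open import Data.Product using (Σ; ∃; _×_; _,_)
open import Relation.Binary.PropositionalEquality using (_≡_; _≢_)

data Stack : Set where
  st₁ st₂ : Stack

-- Which of the five pairwise disjoint sets Σ_c^1, Σ_c^2, Σ_r^1, Σ_r^2, Σ_int
-- a letter belongs to.
data Kind : Set where
  call ret : Stack → Kind
  int      : Kind

record Alphabet : Set where
  field
    size : ℕ
    kind : Fin size → Kind

module _ (A : Alphabet) where
  open Alphabet A

  Letter : Set
  Letter = Fin size

  data WellFormed (s : Stack) : List Letter → Set where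
    wf-nest  : ∀ {a b u} → kind a ≡ call s → WellFormed s u → kind b ≡ ret s →
               WellFormed s (a ∷ (u ++ [ b ]))
    wf-cat   : ∀ {u v} → WellFormed s u → WellFormed s v → WellFormed s (u ++ v)
    wf-eps   : WellFormed s []
    wf-other : ∀ {c} → kind c ≢ call s → kind c ≢ ret s → WellFormed s [ c ]

  -- A nested word ([n], ⋖, μ, λ) is determined by its labelling λ,
  -- represented as a non-empty list of letters. Positions are 0-based:
  -- position p of the list corresponds to position p+1 of [n].
  record NestedWord : Set where
    constructor nw
    field
      labels   : List Letter
      nonEmpty : labels ≢ []

  open NestedWord public

  lab : List Letter → ℕ → Maybe Letter
  lab []       _       = nothing
  lab (x ∷ xs) zero    = just x
  lab (x ∷ xs) (suc p) = lab xs p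

  IsCall IsRet : NestedWord → Stack → ℕ → Set
  IsCall W s i = Σ Letter λ a → lab (labels W) i ≡ just a × kind a ≡ call s
  IsRet  W s i = Σ Letter λ b → lab (labels W) i ≡ just b × kind b ≡ ret s

  Mu^ : Stack → NestedWord → ℕ → ℕ → Set
  Mu^ s W i j = i < j × IsCall W s i × IsRet W s j ×
                WellFormed s (take (j ∸ suc i) (drop (suc i) (labels W)))

  Mu : NestedWord → ℕ → ℕ → Set
  Mu W i j = ∃ λ s → Mu^ s W i j

data Dir : Set where
  right left : Dir
  plus minus : Stack → Dir

module _ (A : Alphabet) where

  Step : NestedWord A → Dir → ℕ → ℕ → Set
  Step W right i i' = i' ≡ suc i
  Step W left  i i' = i ≡ suc i'
  Step W (plus s)  i i' = IsCall A W s i × Mu A W i i'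
  Step W (minus s) i i' = IsRet A W s i × Mu A W i' i

  Reach : NestedWord A → List Dir → ℕ → ℕ → Set
  Reach W w i j =
    Σ (Fin (suc (length w)) → ℕ) λ seq →
      ((k : Fin (suc (length w))) → seq k < length (NestedWord.labels W)) ×
      seq zero ≡ i ×
      seq (fromℕ (length w)) ≡ j ×
      ((k l : Fin (length w)) → seq (inject₁ k) ≡ seq (inject₁ l) → k ≡ l) ×
      ((k : Fin (length w)) → toℕ k ≢ 0 → seq (fromℕ (length w)) ≢ seq (inject₁ k)) ×
      ((k : Fin (length w)) → Step W (lookup w k) (seq (inject₁ k)) (seq (suc k)))

  Circular : List Dir → Set
  Circular w = w ≢ [] × Σ (NestedWord A) λ W → Σ ℕ λ i →
               i < length (NestedWord.labels W) × Reach W w i i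

pow : List Dir → ℕ → List Dir
pow w zero    = []
pow w (suc k) = w ++ pow w k

-- Draw a nested word on a line: positions are points, a ⟶ or ⟵ step is a
-- unit half-circle above the line, and a ±ₛ step is the half-circle over its
-- μ-edge, above the line for s = 1 and below it for s = 2. Edges of the same
-- stack are well nested, so a circular path draws a simple closed curve, and
-- such a curve turns by ±2 half-turns. This is shown combinatorially: merging
-- cusps and removing innermost arcs preserves the turning and leads to three
-- or four vertices. The turn at a vertex only depends on the directions of
-- the two steps meeting there, so the curve of wᵏ turns k times as much as w
-- read cyclically, which is an even amount. Hence 2kh = ±2, impossible for
-- k ≥ 2.

module Submission where

open import Defs
open import Data.Bool as Bool using (Bool; true; false; _∧_; _∨_; not; _xor_; if_then_else_; T)
open import Data.Bool.Properties using (¬-not)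
open import Data.Empty using (⊥; ⊥-elim)
open import Data.Fin as Fin using (Fin; inject₁; fromℕ; toℕ; fromℕ<)
open import Data.Fin.Properties using (toℕ-injective; toℕ-fromℕ<; toℕ-inject₁; toℕ-fromℕ)
open import Data.Integer as ℤ using (ℤ; +_; -[1+_]; ∣_∣; 0ℤ; 1ℤ; -1ℤ) renaming (_≤_ to _≤ℤ_)
import Data.Integer.Properties as ℤP
open import Data.Integer.Tactic.RingSolver
open import Data.List using (List; []; _∷_; _++_; [_]; length; take; drop; map; lookup; upTo; concatMap)
open import Data.List.Membership.Propositional using (_∈_)
open import Data.List.Membership.Propositional.Properties using (∈-upTo⁺; ∈-map⁻)
open import Data.List.Properties using (++-assoc; ++-identityʳ; length-++; length-map; take-take; take-[]; map-++)
open import Data.List.Relation.Unary.All using (All; []; _∷_)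
open import Data.List.Relation.Unary.Any using (here; there)
open import Data.Maybe using (just)
open import Data.Nat using (ℕ; zero; suc; _+_; _*_; _∸_; _<ᵇ_; _<_; _≤_; z≤n; s≤s; _<?_; _≟_; pred; ∣_-_∣; _⊔_)
open import Data.Nat.Properties
  using (<ᵇ⇒<; <⇒<ᵇ; ≤-refl; ≤-reflexive; ≤-trans; ≤-pred; <-irrefl; ≮⇒≥; <⇒≱; <-≤-trans; ≤-<-trans; <-trans; <-cmp;
         +-mono-≤; +-mono-≤-<; +-monoʳ-≤; *-mono-≤; *-monoʳ-≤; *-zeroʳ; n≤1+n; <⇒≤; ≤∧≢⇒<; suc-injective; ≤-antisym;
         +-comm; +-suc; +-identityʳ; 1+n≢n; 1+n≢0; m≤m+n; m+n∸m≡n; m+[n∸m]≡n; n∸n≡0; ∸-monoˡ-≤; m≤n⇒m⊓n≡m;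
         ∣m-n∣≤m⊔n; ⊔-lub; m<m+n; ∣-∣-comm; anyUpTo?; m∸n≡0⇒m≤n; pred[m∸n]≡m∸[1+n])
open import Data.Product using (Σ; _×_; _,_; proj₁; proj₂)
import Data.Sum as Sum
open import Data.Sum using (_⊎_; inj₁; inj₂)
open import Relation.Binary using (tri<; tri≈; tri>)
open import Relation.Binary.PropositionalEquality hiding ([_])
open import Relation.Nullary using (¬_; yes; no; Dec; does)


-- Half-circle curves and their turning

lt : ℕ → ℕ → Bool
lt = _<ᵇ_

between : ℕ → ℕ → ℕ → Bool
between x a b = (lt a x ∧ lt x b) ∨ (lt b x ∧ lt x a)

same : ℕ → ℕ → Bool
same x y = not (lt x y) ∧ not (lt y x)

outside : ℕ → ℕ → ℕ → Bool
outside x a b = not (between x a b) ∧ (not (same x a) ∧ not (same x b))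

-- Two half-circles over [a,b] and [c,d] in the same half-plane cross iff
-- exactly one endpoint of the second lies strictly inside the first.
crosses : ℕ → ℕ → ℕ → ℕ → Bool
crosses a b c d = (between c a b ∧ outside d a b) ∨ (between d a b ∧ outside c a b)

-- A closed curve made of half-circles with endpoints on the x-axis is given by
-- its vertices: the position of an endpoint and the half-plane (st₁ upper,
-- st₂ lower) of the half-circle leaving it. Turning is counted in half-turns.
Vertex : Set
Vertex = ℕ × Stack

-- A half-circle in the upper half-plane run rightwards turns clockwise by π.
arcTurn : Stack → Bool → ℤ
arcTurn st₁ true  = -1ℤ
arcTurn st₁ false = 1ℤ
arcTurn st₂ true  = 1ℤ
arcTurn st₂ false = -1ℤ

-- At a vertex the tangent is vertical: it is continuous between arcs on
-- opposite sides, and reverses (a cusp of ±π) between arcs on the same side.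
cornerTurn : Stack → Stack → Bool → Bool → Bool → Bool → ℤ
cornerTurn st₁ st₂ uv wv uw wu = 0ℤ
cornerTurn st₂ st₁ uv wv uw wu = 0ℤ
cornerTurn st₁ st₁ uv wv uw wu = ℤ.- arcTurn st₁ (if uv xor wv then uw else wu)
cornerTurn st₂ st₂ uv wv uw wu = ℤ.- arcTurn st₂ (if uv xor wv then uw else wu)

turnTable : Bool → Bool → Bool → Bool → Bool → Stack → Stack → ℤ
turnTable uv wv uw wu vw su sv = arcTurn sv vw ℤ.+ cornerTurn su sv uv wv uw wu

-- The turning at v, coming from u, plus the turning along the arc from v to w.
turn : Vertex → Vertex → ℕ → ℤ
turn (u , su) (v , sv) w = turnTable (lt u v) (lt w v) (lt u w) (lt w u) (lt v w) su sv

_⇒ᵇ_ : Bool → Bool → Bool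
false ⇒ᵇ _ = true
true  ⇒ᵇ b = b

modusPonens : ∀ {a b} → (a ⇒ᵇ b) ≡ true → a ≡ true → b ≡ true
modusPonens {true} h refl = h

not-false : ∀ {a} → a ≡ false → not a ≡ true
not-false refl = refl

_≡ℤᵇ_ : ℤ → ℤ → Bool
x ≡ℤᵇ y = does (x ℤ.≟ y)

≡ℤᵇ-sound : ∀ {x y} → (x ≡ℤᵇ y) ≡ true → x ≡ y
≡ℤᵇ-sound {x} {y} h with x ℤ.≟ y
... | yes e = e

∨-sound : ∀ {a b} → (a ∨ b) ≡ true → a ≡ true ⊎ b ≡ true
∨-sound {true} h = inj₁ refl
∨-sound {false} h = inj₂ h

cong₅ : ∀ {A B C D E R : Set} (g : A → B → C → D → E → R) {a a' b b' c c' d d' e e'} →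
        a ≡ a' → b ≡ b' → c ≡ c' → d ≡ d' → e ≡ e' → g a b c d e ≡ g a' b' c' d' e'
cong₅ g refl refl refl refl refl = refl


-- Deciding statements about finitely many points by enumeration

-- Everything below depends on the points only through their relative order,
-- so a statement about n points holds in general once it holds for all
-- points in {0, …, n-1}: replace each point by its rank.
rank : ℕ → List ℕ → ℕ
rank y []       = 0
rank y (x ∷ xs) = (if lt x y then 1 else 0) + rank y xs

lt-irrefl : ∀ y → lt y y ≡ false
lt-irrefl zero    = refl
lt-irrefl (suc y) = lt-irrefl y

lt-true : ∀ {x y} → x < y → lt x y ≡ true
lt-true {x} {y} p with lt x y | <⇒<ᵇ p
... | true | _ = refl

lt-sound : ∀ {x y} → lt x y ≡ true → x < y
lt-sound {x} {y} h = <ᵇ⇒< x y (subst T (sym h) _)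

lt-false : ∀ {x y} → ¬ x < y → lt x y ≡ false
lt-false {x} {y} p with lt x y in eq
... | false = refl
... | true  = ⊥-elim (p (lt-sound eq))

lt-sound' : ∀ {x y} → lt x y ≡ false → ¬ x < y
lt-sound' h p with () ← trans (sym (lt-true p)) h

indicator-mono : ∀ {x y z} → y ≤ z → (if lt x y then 1 else 0) ≤ (if lt x z then 1 else 0)
indicator-mono {x} {y} {z} yz with lt x y in e
... | false = z≤n
... | true rewrite lt-true (<-≤-trans (lt-sound e) yz) = ≤-refl

rank-mono : ∀ {y z} xs → y ≤ z → rank y xs ≤ rank z xs
rank-mono []       yz = z≤n
rank-mono (x ∷ xs) yz = +-mono-≤ (indicator-mono yz) (rank-mono xs yz)

rank-strict : ∀ {y z} xs → y ∈ xs → y < z → rank y xs < rank z xs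
rank-strict {y} (x ∷ xs) (here refl) yz rewrite lt-irrefl y | lt-true yz = s≤s (rank-mono xs (<⇒≤ yz))
rank-strict     (x ∷ xs) (there m)   yz = +-mono-≤-< (indicator-mono (<⇒≤ yz)) (rank-strict xs m yz)

rank≤length : ∀ y xs → rank y xs ≤ length xs
rank≤length y []       = z≤n
rank≤length y (x ∷ xs) with lt x y
... | true  = s≤s (rank≤length y xs)
... | false = ≤-trans (rank≤length y xs) (n≤1+n _)

rank<length : ∀ {y} xs → y ∈ xs → rank y xs < length xs
rank<length {y} (x ∷ xs) (here refl) rewrite lt-irrefl y = s≤s (rank≤length y xs)
rank<length {y} (x ∷ xs) (there m) with lt x y
... | true  = s≤s (rank<length xs m)
... | false = ≤-trans (rank<length xs m) (n≤1+n _)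

rank-preserves-lt : ∀ xs {y z} → y ∈ xs → z ∈ xs → lt (rank y xs) (rank z xs) ≡ lt y z
rank-preserves-lt xs {y} {z} my mz with lt y z in e
... | true  = lt-true (rank-strict xs my (lt-sound e))
... | false = lt-false (λ p → <⇒≱ p (rank-mono xs (≮⇒≥ (lt-sound' e))))

data TurnExpr : Set where
  ‵turn : ℕ → Stack → ℕ → Stack → ℕ → TurnExpr
  _‵+_  : TurnExpr → TurnExpr → TurnExpr
  ‵int  : ℤ → TurnExpr

data Formula : Set where
  ‵crosses    : ℕ → ℕ → ℕ → ℕ → Formula
  ‵same       : ℕ → ℕ → Formula
  ‵between    : ℕ → ℕ → ℕ → Formula
  ‵lt         : ℕ → ℕ → Formula
  ‵true ‵false : Formula
  ‵¬          : Formula → Formula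
  _‵∧_ _‵∨_ _‵⇒_ : Formula → Formula → Formula
  _‵≡_        : TurnExpr → TurnExpr → Formula

infixr 6 _‵∧_
infixr 5 _‵∨_
infixr 4 _‵⇒_
infix 7 _‵≡_

evalTurn : (ℕ → ℕ) → TurnExpr → ℤ
evalTurn pt (‵turn i s j s' k) = turn (pt i , s) (pt j , s') (pt k)
evalTurn pt (a ‵+ b)           = evalTurn pt a ℤ.+ evalTurn pt b
evalTurn pt (‵int z)           = z

eval : (ℕ → ℕ) → Formula → Bool
eval pt (‵crosses a b c d) = crosses (pt a) (pt b) (pt c) (pt d)
eval pt (‵same a b)        = same (pt a) (pt b)
eval pt (‵between x a b)   = between (pt x) (pt a) (pt b)
eval pt (‵lt a b)          = lt (pt a) (pt b)
eval pt ‵true              = true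
eval pt ‵false             = false
eval pt (‵¬ φ)             = not (eval pt φ)
eval pt (φ ‵∧ ψ)           = eval pt φ ∧ eval pt ψ
eval pt (φ ‵∨ ψ)           = eval pt φ ∨ eval pt ψ
eval pt (φ ‵⇒ ψ)           = eval pt φ ⇒ᵇ eval pt ψ
eval pt (a ‵≡ b)           = evalTurn pt a ≡ℤᵇ evalTurn pt b

module OrderInvariance (pt pt' : ℕ → ℕ) (op : ∀ i j → lt (pt' i) (pt' j) ≡ lt (pt i) (pt j)) where
  between-invariant : ∀ x a b → between (pt' x) (pt' a) (pt' b) ≡ between (pt x) (pt a) (pt b)
  between-invariant x a b = cong₂ _∨_ (cong₂ _∧_ (op a x) (op x b)) (cong₂ _∧_ (op b x) (op x a))
  same-invariant : ∀ a b → same (pt' a) (pt' b) ≡ same (pt a) (pt b)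
  same-invariant a b = cong₂ _∧_ (cong not (op a b)) (cong not (op b a))
  outside-invariant : ∀ x a b → outside (pt' x) (pt' a) (pt' b) ≡ outside (pt x) (pt a) (pt b)
  outside-invariant x a b = cong₂ _∧_ (cong not (between-invariant x a b)) (cong₂ _∧_ (cong not (same-invariant x a)) (cong not (same-invariant x b)))
  crosses-invariant : ∀ a b c d → crosses (pt' a) (pt' b) (pt' c) (pt' d) ≡ crosses (pt a) (pt b) (pt c) (pt d)
  crosses-invariant a b c d = cong₂ _∨_ (cong₂ _∧_ (between-invariant c a b) (outside-invariant d a b)) (cong₂ _∧_ (between-invariant d a b) (outside-invariant c a b))
  turn-invariant : ∀ i s j s' k → turn (pt' i , s) (pt' j , s') (pt' k) ≡ turn (pt i , s) (pt j , s') (pt k)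
  turn-invariant i s j s' k = cong₅ (λ a b c d e → turnTable a b c d e s s') (op i j) (op k j) (op i k) (op k i) (op j k)
  evalTurn-invariant : ∀ z → evalTurn pt' z ≡ evalTurn pt z
  evalTurn-invariant (‵turn i s j s' k) = turn-invariant i s j s' k
  evalTurn-invariant (a ‵+ b) = cong₂ ℤ._+_ (evalTurn-invariant a) (evalTurn-invariant b)
  evalTurn-invariant (‵int z) = refl
  eval-invariant : ∀ φ → eval pt' φ ≡ eval pt φ
  eval-invariant (‵crosses a b c d) = crosses-invariant a b c d
  eval-invariant (‵same a b) = same-invariant a b
  eval-invariant (‵between x a b) = between-invariant x a b
  eval-invariant (‵lt a b) = op a b
  eval-invariant ‵true = refl
  eval-invariant ‵false = refl
  eval-invariant (‵¬ φ) = cong not (eval-invariant φ)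
  eval-invariant (φ ‵∧ ψ) = cong₂ _∧_ (eval-invariant φ) (eval-invariant ψ)
  eval-invariant (φ ‵∨ ψ) = cong₂ _∨_ (eval-invariant φ) (eval-invariant ψ)
  eval-invariant (φ ‵⇒ ψ) = cong₂ _⇒ᵇ_ (eval-invariant φ) (eval-invariant ψ)
  eval-invariant (_‵≡_ a b) = cong₂ _≡ℤᵇ_ (evalTurn-invariant a) (evalTurn-invariant b)

lookupOr : ℕ → List ℕ → ℕ → ℕ
lookupOr d []       i       = d
lookupOr d (x ∷ xs) zero    = x
lookupOr d (x ∷ xs) (suc i) = lookupOr d xs i

-- The valuation i ↦ xs[i] (the head beyond the end) naming the points of xs.
valuation : List ℕ → ℕ → ℕ
valuation []       = λ _ → 0
valuation (x ∷ xs) = lookupOr x (x ∷ xs)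

lookupOr-∈ : ∀ d l i → lookupOr d l i ≡ d ⊎ lookupOr d l i ∈ l
lookupOr-∈ d []       i       = inj₁ refl
lookupOr-∈ d (x ∷ xs) zero    = inj₂ (here refl)
lookupOr-∈ d (x ∷ xs) (suc i) = Sum.map₂ there (lookupOr-∈ d xs i)

valuation-∈ : ∀ x xs i → valuation (x ∷ xs) i ∈ (x ∷ xs)
valuation-∈ x xs i with lookupOr-∈ x (x ∷ xs) i
... | inj₁ e = subst (_∈ (x ∷ xs)) (sym e) (here refl)
... | inj₂ m = m

lookupOr-map : ∀ (f : ℕ → ℕ) d l i → lookupOr (f d) (map f l) i ≡ f (lookupOr d l i)
lookupOr-map f d []      i       = refl
lookupOr-map f d (x ∷ l) zero    = refl
lookupOr-map f d (x ∷ l) (suc i) = lookupOr-map f d l i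

vectors : ℕ → ℕ → List (List ℕ)
vectors zero    n = [] ∷ []
vectors (suc l) n = concatMap (λ v → map (_∷ v) (upTo n)) (vectors l n)

allᵇ : {A : Set} → (A → Bool) → List A → Bool
allᵇ P []       = true
allᵇ P (x ∷ xs) = P x ∧ allᵇ P xs

∧-l : ∀ {a b} → (a ∧ b) ≡ true → a ≡ true
∧-l {true} h = refl

∧-r : ∀ {a b} → (a ∧ b) ≡ true → b ≡ true
∧-r {true} h = h

∧-i : ∀ {a b} → a ≡ true → b ≡ true → (a ∧ b) ≡ true
∧-i refl refl = refl

allᵇ-∈ : ∀ {A : Set} {P : A → Bool} {xs x} → allᵇ P xs ≡ true → x ∈ xs → P x ≡ true
allᵇ-∈ {xs = y ∷ ys} h (here refl) = ∧-l h
allᵇ-∈ {xs = y ∷ ys} h (there m)   = allᵇ-∈ (∧-r h) m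

allᵇ-++ : ∀ {A : Set} {P : A → Bool} xs ys → allᵇ P (xs ++ ys) ≡ true → allᵇ P xs ≡ true × allᵇ P ys ≡ true
allᵇ-++ []       ys h = refl , h
allᵇ-++ (x ∷ xs) ys h with allᵇ-++ xs ys (∧-r h)
... | a , b = ∧-i (∧-l h) a , b

allᵇ-map : ∀ {A B : Set} {P : B → Bool} (f : A → B) xs → allᵇ P (map f xs) ≡ true → allᵇ (λ x → P (f x)) xs ≡ true
allᵇ-map f []       h = refl
allᵇ-map f (x ∷ xs) h = ∧-i (∧-l h) (allᵇ-map f xs (∧-r h))

allᵇ-vectors : ∀ {P : List ℕ → Bool} l n → allᵇ P (vectors l n) ≡ true →
               ∀ v → length v ≡ l → (∀ x → x ∈ v → x < n) → P v ≡ true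
allᵇ-vectors zero n h [] refl b = ∧-l h
allᵇ-vectors {P} (suc l) n h (x ∷ v) refl b = allᵇ-∈ allExtensions (∈-upTo⁺ (b x (here refl)))
  where
  extensions : ∀ vs → allᵇ P (concatMap (λ v → map (_∷ v) (upTo n)) vs) ≡ true →
               allᵇ (λ v → allᵇ (λ x → P (x ∷ v)) (upTo n)) vs ≡ true
  extensions []       h = refl
  extensions (v ∷ vs) h with allᵇ-++ (map (_∷ v) (upTo n)) _ h
  ... | a , b = ∧-i (allᵇ-map (_∷ v) (upTo n) a) (extensions vs b)
  allExtensions : allᵇ (λ x → P (x ∷ v)) (upTo n) ≡ true
  allExtensions = allᵇ-vectors {λ v → allᵇ (λ x → P (x ∷ v)) (upTo n)} l n
                    (extensions (vectors l n) h) v refl (λ y m → b y (there m))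

HoldsUpTo : ℕ → Formula → Bool
HoldsUpTo n φ = allᵇ (λ r → eval (valuation r) φ) (vectors n n)

check-sound : ∀ n φ → HoldsUpTo n φ ≡ true → ∀ xs → length xs ≡ n → eval (valuation xs) φ ≡ true
check-sound n φ h []       refl = ∧-l h
check-sound n φ h (x ∷ xs) len  = begin
  eval pt φ      ≡⟨ OrderInvariance.eval-invariant pt ranked rank-order φ ⟨
  eval ranked φ  ≡⟨ OrderInvariance.eval-invariant ranked (valuation ranks) (λ i j → cong₂ lt (valuation-ranks i) (valuation-ranks j)) φ ⟨
  eval (valuation ranks) φ ≡⟨ allᵇ-vectors {λ r → eval (valuation r) φ} n n h ranks (trans (length-map rk L) len) ranks<n ⟩
  true           ∎
  where
  open ≡-Reasoning
  L = x ∷ xs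
  rk : ℕ → ℕ
  rk y = rank y L
  ranks : List ℕ
  ranks = map rk L
  pt ranked : ℕ → ℕ
  pt = valuation L
  ranked i = rk (pt i)
  rank-order : ∀ i j → lt (ranked i) (ranked j) ≡ lt (pt i) (pt j)
  rank-order i j = rank-preserves-lt L (valuation-∈ x xs i) (valuation-∈ x xs j)
  valuation-ranks : ∀ i → valuation ranks i ≡ ranked i
  valuation-ranks i = lookupOr-map rk x L i
  ranks<n : ∀ y → y ∈ ranks → y < n
  ranks<n y m with ∈-map⁻ rk m
  ... | z , zm , refl = subst (rank z L <_) len (rank<length L zm)

opposite : Stack → Stack
opposite st₁ = st₂
opposite st₂ = st₁

‵≢ : ℕ → ℕ → Formula
‵≢ i j = ‵¬ (‵same i j)

‵nonCrossing : ℕ → ℕ → Stack → ℕ → ℕ → Stack → Formula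
‵nonCrossing a b st₁ c d st₁ = ‵¬ (‵crosses a b c d)
‵nonCrossing a b st₂ c d st₂ = ‵¬ (‵crosses a b c d)
‵nonCrossing a b st₁ c d st₂ = ‵true
‵nonCrossing a b st₂ c d st₁ = ‵true

-- An arc from point a to point b on a side.
Edge : Set
Edge = ℕ × ℕ × Stack

‵nonCrossingWith : Edge → List Edge → Formula
‵nonCrossingWith e [] = ‵true
‵nonCrossingWith (a , b , s) ((c , d , s') ∷ es) =
  ‵nonCrossing a b s c d s' ‵∧ ‵nonCrossing c d s' a b s ‵∧ ‵nonCrossingWith (a , b , s) es

‵pairwiseNonCrossing : List Edge → Formula
‵pairwiseNonCrossing []       = ‵true
‵pairwiseNonCrossing (e ∷ es) = ‵nonCrossingWith e es ‵∧ ‵pairwiseNonCrossing es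

-- Points 0 1 2 3 4 of a curve with a cusp at 2: the arcs 1→2 and 2→3 may be
-- replaced by one arc 1→3 on the same side without changing the turning.
cuspMerge-turning : Stack → Stack → Stack → Formula
cuspMerge-turning sp su sw =
  (‵≢ 1 2 ‵∧ ‵≢ 2 3 ‵∧ ‵≢ 1 3 ‵∧ ‵≢ 0 1 ‵∧ ‵≢ 0 2 ‵∧ ‵≢ 0 3 ‵∧ ‵≢ 4 1 ‵∧ ‵≢ 4 2 ‵∧ ‵≢ 4 3 ‵∧
   ‵pairwiseNonCrossing ((0 , 1 , sp) ∷ (1 , 2 , su) ∷ (2 , 3 , su) ∷ (3 , 4 , sw) ∷ []))
  ‵⇒ (‵turn 0 sp 1 su 2 ‵+ (‵turn 1 su 2 su 3 ‵+ ‵turn 2 su 3 sw 4)) ‵≡ (‵turn 0 sp 1 su 3 ‵+ ‵turn 1 su 3 sw 4)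

-- … and the new arc 0→2 meets no arc 3→4 on its side that avoided 0→1→2.
cuspMerge-nonCrossing : Formula
cuspMerge-nonCrossing =
  (‵≢ 0 1 ‵∧ ‵≢ 1 2 ‵∧ ‵≢ 0 2 ‵∧ ‵≢ 3 1 ‵∧ ‵≢ 4 1 ‵∧ ‵¬ (‵crosses 0 1 3 4) ‵∧ ‵¬ (‵crosses 3 4 0 1) ‵∧
   ‵¬ (‵crosses 1 2 3 4) ‵∧ ‵¬ (‵crosses 3 4 1 2))
  ‵⇒ (‵¬ (‵crosses 0 2 3 4) ‵∧ ‵¬ (‵crosses 3 4 0 2))

-- Points 0 … 5 of an alternating curve whose arc 2→3 has no point below it:
-- the path 1→2→3→4 may be replaced by one arc 1→4 without changing the turning.
arcRemoval-turning : Stack → Formula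
arcRemoval-turning s =
  (‵≢ 1 2 ‵∧ ‵≢ 1 3 ‵∧ ‵≢ 1 4 ‵∧ ‵≢ 2 3 ‵∧ ‵≢ 2 4 ‵∧ ‵≢ 3 4 ‵∧ ‵¬ (‵between 1 2 3) ‵∧ ‵¬ (‵between 4 2 3) ‵∧
   ‵¬ (‵crosses 1 2 3 4) ‵∧ ‵¬ (‵crosses 3 4 1 2))
  ‵⇒ (‵turn 0 s 1 s̄ 2 ‵+ (‵turn 1 s̄ 2 s 3 ‵+ (‵turn 2 s 3 s̄ 4 ‵+ ‵turn 3 s̄ 4 s 5)))
     ‵≡ (‵turn 0 s 1 s̄ 4 ‵+ ‵turn 1 s̄ 4 s 5)
  where s̄ = opposite s

-- … and the new arc 0→3 meets no arc 4→5 on its side that avoided 0→1 and 2→3.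
arcRemoval-nonCrossing : Formula
arcRemoval-nonCrossing =
  (‵≢ 0 1 ‵∧ ‵≢ 0 2 ‵∧ ‵≢ 0 3 ‵∧ ‵≢ 1 2 ‵∧ ‵≢ 1 3 ‵∧ ‵≢ 2 3 ‵∧
   ‵¬ (‵between 4 1 2) ‵∧ ‵¬ (‵between 5 1 2) ‵∧ ‵≢ 4 1 ‵∧ ‵≢ 4 2 ‵∧ ‵≢ 5 1 ‵∧ ‵≢ 5 2 ‵∧
   ‵¬ (‵crosses 0 1 4 5) ‵∧ ‵¬ (‵crosses 4 5 0 1) ‵∧ ‵¬ (‵crosses 2 3 4 5) ‵∧ ‵¬ (‵crosses 4 5 2 3))
  ‵⇒ (‵¬ (‵crosses 0 3 4 5) ‵∧ ‵¬ (‵crosses 4 5 0 3))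

2ℤ -2ℤ : ℤ
2ℤ  = + 2
-2ℤ = -[1+ 1 ]

Is±2 : ℤ → Set
Is±2 z = z ≡ 2ℤ ⊎ z ≡ -2ℤ

‵±2 : TurnExpr → Formula
‵±2 z = z ‵≡ ‵int 2ℤ ‵∨ z ‵≡ ‵int -2ℤ

triangleTurning : Stack → Stack → Stack → TurnExpr
triangleTurning s0 s1 s2 = ‵turn 0 s0 1 s1 2 ‵+ (‵turn 1 s1 2 s2 0 ‵+ (‵turn 2 s2 0 s0 1 ‵+ ‵int 0ℤ))

triangle-±2 : Stack → Stack → Stack → Formula
triangle-±2 s0 s1 s2 = (‵≢ 0 1 ‵∧ ‵≢ 1 2 ‵∧ ‵≢ 0 2) ‵⇒ ‵±2 (triangleTurning s0 s1 s2)

quadrilateralTurning : Stack → Stack → Stack → Stack → TurnExpr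
quadrilateralTurning s0 s1 s2 s3 =
  ‵turn 0 s0 1 s1 2 ‵+ (‵turn 1 s1 2 s2 3 ‵+ (‵turn 2 s2 3 s3 0 ‵+ (‵turn 3 s3 0 s0 1 ‵+ ‵int 0ℤ)))

quadrilateral-±2 : Stack → Stack → Stack → Stack → Formula
quadrilateral-±2 s0 s1 s2 s3 =
  (‵≢ 0 1 ‵∧ ‵≢ 0 2 ‵∧ ‵≢ 0 3 ‵∧ ‵≢ 1 2 ‵∧ ‵≢ 1 3 ‵∧ ‵≢ 2 3 ‵∧
   ‵pairwiseNonCrossing ((0 , 1 , s0) ∷ (1 , 2 , s1) ∷ (2 , 3 , s2) ∷ (3 , 0 , s3) ∷ []))
  ‵⇒ ‵±2 (quadrilateralTurning s0 s1 s2 s3)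


cuspMerge-turning-holds : ∀ sp su sw → HoldsUpTo 5 (cuspMerge-turning sp su sw) ≡ true
cuspMerge-turning-holds st₁ st₁ st₁ = refl
cuspMerge-turning-holds st₁ st₁ st₂ = refl
cuspMerge-turning-holds st₁ st₂ st₁ = refl
cuspMerge-turning-holds st₁ st₂ st₂ = refl
cuspMerge-turning-holds st₂ st₁ st₁ = refl
cuspMerge-turning-holds st₂ st₁ st₂ = refl
cuspMerge-turning-holds st₂ st₂ st₁ = refl
cuspMerge-turning-holds st₂ st₂ st₂ = refl

cuspMerge-nonCrossing-holds : HoldsUpTo 5 cuspMerge-nonCrossing ≡ true
cuspMerge-nonCrossing-holds = refl

arcRemoval-turning-holds : ∀ s → HoldsUpTo 6 (arcRemoval-turning s) ≡ true
arcRemoval-turning-holds st₁ = refl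
arcRemoval-turning-holds st₂ = refl

arcRemoval-nonCrossing-holds : HoldsUpTo 6 arcRemoval-nonCrossing ≡ true
arcRemoval-nonCrossing-holds = refl

triangle-±2-holds : ∀ s0 s1 s2 → HoldsUpTo 3 (triangle-±2 s0 s1 s2) ≡ true
triangle-±2-holds st₁ st₁ st₁ = refl
triangle-±2-holds st₁ st₁ st₂ = refl
triangle-±2-holds st₁ st₂ st₁ = refl
triangle-±2-holds st₁ st₂ st₂ = refl
triangle-±2-holds st₂ st₁ st₁ = refl
triangle-±2-holds st₂ st₁ st₂ = refl
triangle-±2-holds st₂ st₂ st₁ = refl
triangle-±2-holds st₂ st₂ st₂ = refl

quadrilateral-±2-holds : ∀ s0 s1 s2 s3 → HoldsUpTo 4 (quadrilateral-±2 s0 s1 s2 s3) ≡ true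
quadrilateral-±2-holds st₁ st₁ st₁ st₁ = refl
quadrilateral-±2-holds st₁ st₁ st₁ st₂ = refl
quadrilateral-±2-holds st₁ st₁ st₂ st₁ = refl
quadrilateral-±2-holds st₁ st₁ st₂ st₂ = refl
quadrilateral-±2-holds st₁ st₂ st₁ st₁ = refl
quadrilateral-±2-holds st₁ st₂ st₁ st₂ = refl
quadrilateral-±2-holds st₁ st₂ st₂ st₁ = refl
quadrilateral-±2-holds st₁ st₂ st₂ st₂ = refl
quadrilateral-±2-holds st₂ st₁ st₁ st₁ = refl
quadrilateral-±2-holds st₂ st₁ st₁ st₂ = refl
quadrilateral-±2-holds st₂ st₁ st₂ st₁ = refl
quadrilateral-±2-holds st₂ st₁ st₂ st₂ = refl
quadrilateral-±2-holds st₂ st₂ st₁ st₁ = refl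
quadrilateral-±2-holds st₂ st₂ st₁ st₂ = refl
quadrilateral-±2-holds st₂ st₂ st₂ st₁ = refl
quadrilateral-±2-holds st₂ st₂ st₂ st₂ = refl

-- Closed curves

pos : Vertex → ℕ
pos = proj₁
side : Vertex → Stack
side = proj₂

pathTurning : List Vertex → ℤ
pathTurning [] = + 0
pathTurning (a ∷ []) = + 0
pathTurning (a ∷ b ∷ []) = + 0
pathTurning (a ∷ b ∷ c ∷ r) = turn a b (pos c) ℤ.+ pathTurning (b ∷ c ∷ r)

-- Repeating the first two vertices makes every vertex of the closed curve a
-- middle vertex exactly once.
totalTurning : List Vertex → ℤ
totalTurning L = pathTurning (L ++ take 2 L)

lastTwo : Vertex → Vertex → List Vertex → Vertex × Vertex
lastTwo a b [] = a , b
lastTwo a b (c ∷ X) = lastTwo b c X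

pathTurning-snoc : ∀ a b X y → pathTurning (a ∷ b ∷ X ++ y ∷ []) ≡ pathTurning (a ∷ b ∷ X) ℤ.+ turn (proj₁ (lastTwo a b X)) (proj₂ (lastTwo a b X)) (pos y)
pathTurning-snoc a b [] y = trans (ℤP.+-identityʳ (turn a b (pos y))) (sym (ℤP.+-identityˡ (turn a b (pos y))))
pathTurning-snoc a b (c ∷ X) y = trans (cong (λ z → turn a b (pos c) ℤ.+ z) (pathTurning-snoc b c X y)) (sym (ℤP.+-assoc (turn a b (pos c)) _ _))

lastTwo-snoc : ∀ a b X y → lastTwo a b (X ++ y ∷ []) ≡ (proj₂ (lastTwo a b X) , y)
lastTwo-snoc a b [] y = refl
lastTwo-snoc a b (c ∷ X) y = lastTwo-snoc b c X y

pathTurning-snoc² : ∀ a b X y z → pathTurning (a ∷ b ∷ X ++ y ∷ z ∷ []) ≡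
   pathTurning (a ∷ b ∷ X) ℤ.+ turn (proj₁ (lastTwo a b X)) (proj₂ (lastTwo a b X)) (pos y) ℤ.+ turn (proj₂ (lastTwo a b X)) y (pos z)
pathTurning-snoc² a b X y z = begin
  pathTurning (a ∷ b ∷ X ++ y ∷ z ∷ [])   ≡⟨ cong (λ l → pathTurning (a ∷ b ∷ l)) (sym (++-assoc X (y ∷ []) (z ∷ []))) ⟩
  pathTurning (a ∷ b ∷ (X ++ y ∷ []) ++ z ∷ []) ≡⟨ pathTurning-snoc a b (X ++ y ∷ []) z ⟩
  pathTurning (a ∷ b ∷ X ++ y ∷ []) ℤ.+ turn (proj₁ (lastTwo a b (X ++ y ∷ []))) (proj₂ (lastTwo a b (X ++ y ∷ []))) (pos z)
     ≡⟨ cong₂ ℤ._+_ (pathTurning-snoc a b X y) (cong (λ pr → turn (proj₁ pr) (proj₂ pr) (pos z)) (lastTwo-snoc a b X y)) ⟩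
  _ ∎ where open ≡-Reasoning

-- Beyond the end of the list the junk vertex (0 , st₁) is returned.
at : List Vertex → ℕ → Vertex
at [] _ = 0 , st₁
at (x ∷ xs) zero = x
at (x ∷ xs) (suc i) = at xs i

at-++ˡ : ∀ K Y t → t < length K → at (K ++ Y) t ≡ at K t
at-++ˡ (x ∷ K) Y zero p = refl
at-++ˡ (x ∷ K) Y (suc t) (s≤s p) = at-++ˡ K Y t p

at-++ʳ : ∀ K Y → at (K ++ Y) (length K) ≡ at Y 0
at-++ʳ [] Y = refl
at-++ʳ (x ∷ K) Y = at-++ʳ K Y

lastTwo-at : ∀ a b X → lastTwo a b X ≡ (at (a ∷ b ∷ X) (length X) , at (a ∷ b ∷ X) (suc (length X)))
lastTwo-at a b [] = refl
lastTwo-at a b (c ∷ X) = lastTwo-at b c X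

pathTurning-close : ∀ w q K y z →
  pathTurning (w ∷ q ∷ K ++ y ∷ z ∷ []) ≡
  pathTurning (w ∷ q ∷ K) ℤ.+ (turn (at (w ∷ q ∷ K) (length K)) (at (w ∷ q ∷ K) (suc (length K))) (pos y) ℤ.+
                               turn (at (w ∷ q ∷ K) (suc (length K))) y (pos z))
pathTurning-close w q K y z = begin
  pathTurning (w ∷ q ∷ K ++ y ∷ z ∷ [])
    ≡⟨ pathTurning-snoc² w q K y z ⟩
  pathTurning (w ∷ q ∷ K) ℤ.+ turn (proj₁ (lastTwo w q K)) (proj₂ (lastTwo w q K)) (pos y) ℤ.+ turn (proj₂ (lastTwo w q K)) y (pos z)
    ≡⟨ cong (λ pr → pathTurning (w ∷ q ∷ K) ℤ.+ turn (proj₁ pr) (proj₂ pr) (pos y) ℤ.+ turn (proj₂ pr) y (pos z)) (lastTwo-at w q K) ⟩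
  pathTurning (w ∷ q ∷ K) ℤ.+ turn P U (pos y) ℤ.+ turn U y (pos z)
    ≡⟨ ℤP.+-assoc (pathTurning (w ∷ q ∷ K)) _ _ ⟩
  pathTurning (w ∷ q ∷ K) ℤ.+ (turn P U (pos y) ℤ.+ turn U y (pos z)) ∎
  where
  open ≡-Reasoning
  P U : Vertex
  P = at (w ∷ q ∷ K) (length K)
  U = at (w ∷ q ∷ K) (suc (length K))

next : ℕ → ℕ → ℕ
next N t with suc t <? N
... | yes _ = suc t
... | no _ = 0

prev : ℕ → ℕ → ℕ
prev N zero = pred N
prev N (suc t) = t

module Cyclic (N : ℕ) where
  next< : ∀ t → t < N → next N t < N
  next< t p with suc t <? N
  ... | yes q = q
  ... | no _ = ≤-trans (s≤s z≤n) p

  next-suc : ∀ t → suc t < N → next N t ≡ suc t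
  next-suc t p with suc t <? N
  ... | yes _ = refl
  ... | no q = ⊥-elim (q p)

  next-last : ∀ t → suc t ≡ N → next N t ≡ 0
  next-last t p with suc t <? N
  ... | yes q = ⊥-elim (<-irrefl p q)
  ... | no _ = refl

  next-injective : ∀ t t' → t < N → t' < N → next N t ≡ next N t' → t ≡ t'
  next-injective t t' p p' e with suc t <? N | suc t' <? N
  ... | yes _ | yes _ = suc-injective e
  ... | yes _ | no _ = ⊥-elim (1+n≢0 e)
  ... | no _ | yes _ = ⊥-elim (1+n≢0 (sym e))
  ... | no q | no q' = suc-injective (trans (≤-antisym p (≮⇒≥ q)) (sym (≤-antisym p' (≮⇒≥ q'))))

  prev< : ∀ t → t < N → prev N t < N
  prev< zero p = lem N p where
    lem : ∀ N → 0 < N → suc (pred N) ≤ N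
    lem (suc N) _ = ≤-refl
  prev< (suc t) p = ≤-trans (n≤1+n _) p

  next-prev : ∀ t → t < N → next N (prev N t) ≡ t
  next-prev zero p = next-last (pred N) (lem N p) where
    lem : ∀ N → 0 < N → suc (pred N) ≡ N
    lem (suc N) _ = refl
  next-prev (suc t) p = next-suc t p

rotate : List Vertex → List Vertex
rotate [] = []
rotate (x ∷ K) = K ++ x ∷ []

length-rotate : ∀ L → length (rotate L) ≡ length L
length-rotate [] = refl
length-rotate (x ∷ K) = trans (length-++ K) (+-comm (length K) 1)

at-rotate : ∀ L t → t < length L → at (rotate L) t ≡ at L (next (length L) t)
at-rotate (x ∷ K) t p with suc t <? suc (length K)
... | yes (s≤s q) = at-++ˡ K (x ∷ []) t q
... | no q with ≤-antisym p (≮⇒≥ q)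
... | refl = at-++ʳ K (x ∷ [])

totalTurning-rotate : ∀ x y z R → totalTurning (rotate (x ∷ y ∷ z ∷ R)) ≡ totalTurning (x ∷ y ∷ z ∷ R)
totalTurning-rotate x y z R = begin
  pathTurning ((y ∷ z ∷ R ++ x ∷ []) ++ y ∷ z ∷ [])  ≡⟨ cong (λ l → pathTurning (y ∷ z ∷ l)) (++-assoc R (x ∷ []) (y ∷ z ∷ [])) ⟩
  pathTurning (y ∷ z ∷ R ++ x ∷ y ∷ z ∷ [])  ≡⟨ cong (λ l → pathTurning (y ∷ z ∷ l)) (sym (++-assoc R (x ∷ []) (y ∷ z ∷ []))) ⟩
  pathTurning (y ∷ z ∷ (R ++ x ∷ []) ++ y ∷ z ∷ [])  ≡⟨ pathTurning-snoc² y z (R ++ x ∷ []) y z ⟩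
  pathTurning (y ∷ z ∷ R ++ x ∷ []) ℤ.+ turn (proj₁ (lastTwo y z (R ++ x ∷ []))) (proj₂ (lastTwo y z (R ++ x ∷ []))) (pos y)
    ℤ.+ turn (proj₂ (lastTwo y z (R ++ x ∷ []))) y (pos z)
     ≡⟨ cong (λ pr → pathTurning (y ∷ z ∷ R ++ x ∷ []) ℤ.+ turn (proj₁ pr) (proj₂ pr) (pos y) ℤ.+ turn (proj₂ pr) y (pos z)) (lastTwo-snoc y z R x) ⟩
  pathTurning (y ∷ z ∷ R ++ x ∷ []) ℤ.+ turn (proj₂ (lastTwo y z R)) x (pos y) ℤ.+ turn x y (pos z)
     ≡⟨ ℤP.+-comm _ (turn x y (pos z)) ⟩
  turn x y (pos z) ℤ.+ (pathTurning (y ∷ z ∷ R ++ x ∷ []) ℤ.+ turn (proj₂ (lastTwo y z R)) x (pos y))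
     ≡⟨ cong (λ m → turn x y (pos z) ℤ.+ (m ℤ.+ turn (proj₂ (lastTwo y z R)) x (pos y))) (pathTurning-snoc y z R x) ⟩
  turn x y (pos z) ℤ.+ (pathTurning (y ∷ z ∷ R) ℤ.+ turn (proj₁ (lastTwo y z R)) (proj₂ (lastTwo y z R)) (pos x) ℤ.+ turn (proj₂ (lastTwo y z R)) x (pos y))
     ≡⟨ cong (λ m → turn x y (pos z) ℤ.+ m) (sym (pathTurning-snoc² y z R x y)) ⟩
  pathTurning (x ∷ y ∷ z ∷ R ++ x ∷ y ∷ []) ∎
  where open ≡-Reasoning

rotate^ : ℕ → List Vertex → List Vertex
rotate^ zero L = L
rotate^ (suc j) L = rotate^ j (rotate L)

length-rotate^ : ∀ j L → length (rotate^ j L) ≡ length L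
length-rotate^ zero L = refl
length-rotate^ (suc j) L = trans (length-rotate^ j (rotate L)) (length-rotate L)

totalTurning-rotate^ : ∀ j L → 3 ≤ length L → totalTurning (rotate^ j L) ≡ totalTurning L
totalTurning-rotate^ zero L p = refl
totalTurning-rotate^ (suc j) (x ∷ []) (s≤s ())
totalTurning-rotate^ (suc j) (x ∷ y ∷ []) (s≤s (s≤s ()))
totalTurning-rotate^ (suc j) (x ∷ y ∷ z ∷ R) p =
  trans (totalTurning-rotate^ j (rotate (x ∷ y ∷ z ∷ R)) (subst (3 ≤_) (sym (length-rotate (x ∷ y ∷ z ∷ R))) p)) (totalTurning-rotate x y z R)

shift : ℕ → ℕ → ℕ → ℕ
shift N zero t = t
shift N (suc j) t = next N (shift N j t)

module Shift (N : ℕ) where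
  open Cyclic N
  shift< : ∀ j t → t < N → shift N j t < N
  shift< zero t p = p
  shift< (suc j) t p = next< _ (shift< j t p)

  at-rotate^ : ∀ j L t → length L ≡ N → t < N → at (rotate^ j L) t ≡ at L (shift N j t)
  at-rotate^ zero L t e p = refl
  at-rotate^ (suc j) L t e p = trans (at-rotate^ j (rotate L) t (trans (length-rotate L) e) p)
     (trans (at-rotate L (shift N j t) (subst (shift N j t <_) (sym e) (shift< j t p))) (cong (λ n → at L (next n (shift N j t))) e))

  shift-next : ∀ j t → shift N j (next N t) ≡ next N (shift N j t)
  shift-next zero t = refl
  shift-next (suc j) t = cong (next N) (shift-next j t)

  shift-zero : ∀ j → j < N → shift N j 0 ≡ j
  shift-zero zero p = refl
  shift-zero (suc j) p = trans (cong (next N) (shift-zero j (≤-trans (n≤1+n _) p))) (next-suc j p)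

  shift-injective : ∀ j {t t'} → t < N → t' < N → shift N j t ≡ shift N j t' → t ≡ t'
  shift-injective zero    _ _ h = h
  shift-injective (suc j) a b h = shift-injective j a b (next-injective _ _ (shift< j _ a) (shift< j _ b) h)

  shift-prev : ∀ j t → t < N → shift N j (prev N t) ≡ prev N (shift N j t)
  shift-prev j t p = next-injective _ _ (shift< j _ (prev< t p)) (prev< _ (shift< j t p))
    (trans (sym (shift-next j (prev N t))) (trans (cong (shift N j) (next-prev t p)) (sym (next-prev _ (shift< j t p)))))

DistinctPositions : List Vertex → Set
DistinctPositions L = ∀ t t' → t < length L → t' < length L → pos (at L t) ≡ pos (at L t') → t ≡ t'

NonCrossing : List Vertex → Set
NonCrossing L = ∀ t t' → t < length L → t' < length L → side (at L t) ≡ side (at L t') →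
  crosses (pos (at L t)) (pos (at L (next (length L) t))) (pos (at L t')) (pos (at L (next (length L) t'))) ≡ false

Alternating : List Vertex → Set
Alternating L = ∀ t → t < length L → side (at L t) ≢ side (at L (next (length L) t))

module Rotation (L : List Vertex) where
  N : ℕ
  N = length L
  open Cyclic N
  open Shift N
  L′ : ℕ → List Vertex
  L′ j = rotate^ j L
  length-L′ : ∀ j → length (L′ j) ≡ N
  length-L′ j = length-rotate^ j L
  at-L′ : ∀ j t → t < N → at (L′ j) t ≡ at L (shift N j t)
  at-L′ j t p = at-rotate^ j L t refl p
  at-L′-next : ∀ j t → t < N → at (L′ j) (next (length (L′ j)) t) ≡ at L (next N (shift N j t))
  at-L′-next j t p rewrite length-L′ j = trans (at-L′ j (next N t) (next< t p)) (cong (at L) (shift-next j t))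
  <length-L′ : ∀ {j t} → t < length (L′ j) → t < N
  <length-L′ {j} p = subst (_ <_) (length-L′ j) p

  distinct : DistinctPositions L → ∀ j → DistinctPositions (L′ j)
  distinct u j t t' p p' q = shift-injective j (<length-L′ {j} p) (<length-L′ {j} p')
    (u _ _ (shift< j t (<length-L′ {j} p)) (shift< j t' (<length-L′ {j} p'))
       (trans (sym (cong pos (at-L′ j t (<length-L′ {j} p)))) (trans q (cong pos (at-L′ j t' (<length-L′ {j} p'))))))

  nonCrossing : NonCrossing L → ∀ j → NonCrossing (L′ j)
  nonCrossing n j t t' p p' q
    rewrite at-L′ j t (<length-L′ {j} p) | at-L′ j t' (<length-L′ {j} p') | at-L′-next j t (<length-L′ {j} p) | at-L′-next j t' (<length-L′ {j} p') =
    n _ _ (shift< j t (<length-L′ {j} p)) (shift< j t' (<length-L′ {j} p')) q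

  alternating : Alternating L → ∀ j → Alternating (L′ j)
  alternating a j t p rewrite at-L′ j t (<length-L′ {j} p) | at-L′-next j t (<length-L′ {j} p) = a _ (shift< j t (<length-L′ {j} p))

-- Simple closed curves turn by ±2 half-turns

same-false : ∀ {x y} → x ≢ y → same x y ≡ false
same-false {x} {y} ne with lt x y in e1 | lt y x in e2
... | true | _ = refl
... | false | true = refl
... | false | false = ⊥-elim (ne (≤-antisym (≮⇒≥ (lt-sound' e2)) (≮⇒≥ (lt-sound' e1))))

‵≢-holds : ∀ pt i j → pt i ≢ pt j → eval pt (‵≢ i j) ≡ true
‵≢-holds pt i j ne = not-false (same-false ne)

‵¬between-holds : ∀ pt i j k → between (pt i) (pt j) (pt k) ≡ false → eval pt (‵¬ (‵between i j k)) ≡ true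
‵¬between-holds pt i j k h = not-false h

‵nonCrossing-holds : ∀ pt i j s k l s' → (s ≡ s' → crosses (pt i) (pt j) (pt k) (pt l) ≡ false) → eval pt (‵nonCrossing i j s k l s') ≡ true
‵nonCrossing-holds pt i j st₁ k l st₁ h = not-false (h refl)
‵nonCrossing-holds pt i j st₂ k l st₂ h = not-false (h refl)
‵nonCrossing-holds pt i j st₁ k l st₂ h = refl
‵nonCrossing-holds pt i j st₂ k l st₁ h = refl

not-true : ∀ {a} → not a ≡ true → a ≡ false
not-true {false} _ = refl

crosses-self : ∀ a b → crosses a b a b ≡ false
crosses-self a b rewrite lt-irrefl a | lt-irrefl b with lt a b | lt b a
... | true | true = refl
... | true | false = refl
... | false | true = refl
... | false | false = refl

record IsEdgeOf (pt : ℕ → ℕ) (L : List Vertex) (e : Edge) : Set where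
  field
    index    : ℕ
    index<   : index < length L
    source≡  : pt (proj₁ e) ≡ pos (at L index)
    target≡  : pt (proj₁ (proj₂ e)) ≡ pos (at L (next (length L) index))
    side≡    : proj₂ (proj₂ e) ≡ side (at L index)

edges-nonCrossing : ∀ pt L → NonCrossing L → ∀ e e' → IsEdgeOf pt L e → IsEdgeOf pt L e' →
   (proj₂ (proj₂ e) ≡ proj₂ (proj₂ e') → crosses (pt (proj₁ e)) (pt (proj₁ (proj₂ e))) (pt (proj₁ e')) (pt (proj₁ (proj₂ e'))) ≡ false)
edges-nonCrossing pt L n (a , b , s) (c , d , s') o o' se
  rewrite IsEdgeOf.source≡ o | IsEdgeOf.target≡ o | IsEdgeOf.source≡ o' | IsEdgeOf.target≡ o' =
  n (IsEdgeOf.index o) (IsEdgeOf.index o') (IsEdgeOf.index< o) (IsEdgeOf.index< o') (trans (sym (IsEdgeOf.side≡ o)) (trans se (IsEdgeOf.side≡ o')))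

‵pairwiseNonCrossing-holds : ∀ pt L → NonCrossing L → ∀ es → All (IsEdgeOf pt L) es → eval pt (‵pairwiseNonCrossing es) ≡ true
‵pairwiseNonCrossing-holds pt L n [] [] = refl
‵pairwiseNonCrossing-holds pt L n (e ∷ es) (o ∷ os) = ∧-i (one es os) (‵pairwiseNonCrossing-holds pt L n es os)
  where
  one : ∀ es → All (IsEdgeOf pt L) es → eval pt (‵nonCrossingWith e es) ≡ true
  one [] [] = refl
  one ((c , d , s') ∷ es) (o' ∷ os) =
    ∧-i (‵nonCrossing-holds pt _ _ _ c d s' (edges-nonCrossing pt L n e _ o o'))
    (∧-i (‵nonCrossing-holds pt c d s' _ _ _ (edges-nonCrossing pt L n _ e o' o)) (one es os))

-- L has a cusp at its first vertex v (the arcs U→v and v→w lie on the same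
-- side); Z replaces them by one arc U→w.
module CuspMerge (v w q : Vertex) (K : List Vertex) where
  Z : List Vertex
  Z = w ∷ q ∷ K
  L : List Vertex
  L = v ∷ Z
  m : ℕ
  m = suc (length K)

  nxZ-old : ∀ t → suc t < suc m → next (suc m) t ≡ suc t
  nxZ-old t p = Cyclic.next-suc (suc m) t p
  nxZ-new : next (suc m) m ≡ 0
  nxZ-new = Cyclic.next-last (suc m) m refl
  nxL : ∀ t → suc t < suc m → next (suc (suc m)) (suc t) ≡ suc (suc t)
  nxL t p = Cyclic.next-suc (suc (suc m)) (suc t) (s≤s p)
  nxL-last : next (suc (suc m)) (suc m) ≡ 0
  nxL-last = Cyclic.next-last (suc (suc m)) (suc m) refl
  nxL-0 : next (suc (suc m)) 0 ≡ 1
  nxL-0 = Cyclic.next-suc (suc (suc m)) 0 (s≤s (s≤s z≤n))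

  distinct′ : DistinctPositions L → DistinctPositions Z
  distinct′ u t t' p p' e = suc-injective (u (suc t) (suc t') (s≤s p) (s≤s p') e)

  split : ∀ t → t < suc m → suc t < suc m ⊎ t ≡ m
  split t p with suc t <? suc m
  ... | yes q = inj₁ q
  ... | no q = inj₂ (suc-injective (≤-antisym p (≮⇒≥ q)))

  U : Vertex
  U = at Z m
  P : Vertex
  P = at Z (length K)

  module _ (u : DistinctPositions L) (n : NonCrossing L) (cusp : side U ≡ side v) (K≠ : 1 ≤ length K) where
    posne : ∀ {i j} → i < suc (suc m) → j < suc (suc m) → i ≢ j → pos (at L i) ≢ pos (at L j)
    posne p p' ne e = ne (u _ _ p p' e)

    newEdge-nonCrossing : ∀ t' → suc t' < suc m → side U ≡ side (at Z t') →
      (crosses (pos U) (pos w) (pos (at Z t')) (pos (at Z (suc t'))) ≡ false) × (crosses (pos (at Z t')) (pos (at Z (suc t'))) (pos U) (pos w) ≡ false)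
    newEdge-nonCrossing t' p se = not-true (∧-l concl) , not-true (∧-r concl)
      where
      pt : ℕ → ℕ
      pt = valuation (pos U ∷ pos v ∷ pos w ∷ pos (at Z t') ∷ pos (at Z (suc t')) ∷ [])
      fin : eval pt cuspMerge-nonCrossing ≡ true
      fin = check-sound 5 cuspMerge-nonCrossing cuspMerge-nonCrossing-holds (pos U ∷ pos v ∷ pos w ∷ pos (at Z t') ∷ pos (at Z (suc t')) ∷ []) refl
      iU : suc m < suc (suc m)
      iU = ≤-refl
      it : suc t' < suc (suc m)
      it = s≤s (≤-trans (n≤1+n _) p)
      it2 : suc (suc t') < suc (suc m)
      it2 = s≤s p
      nUv : pos U ≢ pos v
      nUv = posne iU (s≤s z≤n) (λ ())
      nvw : pos v ≢ pos w
      nvw = posne {0} {1} (s≤s z≤n) (s≤s (s≤s z≤n)) (λ ())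
      nUw : pos U ≢ pos w
      nUw = posne {suc m} {1} iU (s≤s (s≤s z≤n)) (λ e → 1+n≢0 (suc-injective e))
      ncv : pos (at Z t') ≢ pos v
      ncv = posne {suc t'} {0} it (s≤s z≤n) (λ ())
      ndv : pos (at Z (suc t')) ≢ pos v
      ndv = posne {suc (suc t')} {0} it2 (s≤s z≤n) (λ ())
      e1 : crosses (pos U) (pos v) (pos (at Z t')) (pos (at Z (suc t'))) ≡ false
      e1 = subst₂ (λ a b → crosses (pos U) (pos (at L a)) (pos (at Z t')) (pos (at L b)) ≡ false) nxL-last (nxL t' p)
             (n (suc m) (suc t') iU it se)
      e2 : crosses (pos (at Z t')) (pos (at Z (suc t'))) (pos U) (pos v) ≡ false
      e2 = subst₂ (λ a b → crosses (pos (at Z t')) (pos (at L b)) (pos U) (pos (at L a)) ≡ false) nxL-last (nxL t' p)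
             (n (suc t') (suc m) it iU (sym se))
      e3 : crosses (pos v) (pos w) (pos (at Z t')) (pos (at Z (suc t'))) ≡ false
      e3 = subst₂ (λ a b → crosses (pos v) (pos (at L a)) (pos (at Z t')) (pos (at L b)) ≡ false) nxL-0 (nxL t' p)
             (n 0 (suc t') (s≤s z≤n) it (trans (sym cusp) se))
      e4 : crosses (pos (at Z t')) (pos (at Z (suc t'))) (pos v) (pos w) ≡ false
      e4 = subst₂ (λ a b → crosses (pos (at Z t')) (pos (at L b)) (pos v) (pos (at L a)) ≡ false) nxL-0 (nxL t' p)
             (n (suc t') 0 it (s≤s z≤n) (trans (sym se) cusp))
      cond : eval pt (‵≢ 0 1 ‵∧ ‵≢ 1 2 ‵∧ ‵≢ 0 2 ‵∧ ‵≢ 3 1 ‵∧ ‵≢ 4 1 ‵∧ ‵¬ (‵crosses 0 1 3 4) ‵∧ ‵¬ (‵crosses 3 4 0 1) ‵∧ ‵¬ (‵crosses 1 2 3 4) ‵∧ ‵¬ (‵crosses 3 4 1 2)) ≡ true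
      cond = ∧-i (‵≢-holds pt 0 1 nUv) (∧-i (‵≢-holds pt 1 2 nvw) (∧-i (‵≢-holds pt 0 2 nUw) (∧-i (‵≢-holds pt 3 1 ncv) (∧-i (‵≢-holds pt 4 1 ndv)
             (∧-i (not-false e1) (∧-i (not-false e2) (∧-i (not-false e3) (not-false e4))))))))
      concl = modusPonens fin cond

    nonCrossing′ : NonCrossing Z
    nonCrossing′ t t' p p' se with split t p | split t' p'
    ... | inj₁ a | inj₁ b rewrite nxZ-old t a | nxZ-old t' b =
      subst₂ (λ x y → crosses (pos (at Z t)) (pos (at L x)) (pos (at Z t')) (pos (at L y)) ≡ false) (nxL t a) (nxL t' b)
        (n (suc t) (suc t') (s≤s p) (s≤s p') se)
    ... | inj₂ refl | inj₁ b rewrite nxZ-new | nxZ-old t' b = proj₁ (newEdge-nonCrossing t' b se)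
    ... | inj₁ a | inj₂ refl rewrite nxZ-new | nxZ-old t a = proj₂ (newEdge-nonCrossing t a (sym se))
    ... | inj₂ refl | inj₂ refl rewrite nxZ-new = crosses-self (pos U) (pos w)

    cusp-turns : turn P U (pos v) ℤ.+ (turn U v (pos w) ℤ.+ turn v w (pos q)) ≡ turn P U (pos w) ℤ.+ turn U w (pos q)
    cusp-turns = subst (λ UU → turn P UU (pos v) ℤ.+ (turn UU v (pos w) ℤ.+ turn v w (pos q)) ≡ turn P UU (pos w) ℤ.+ turn UU w (pos q))
              (sym Ueq) concl
      where
      xs : List ℕ
      xs = pos P ∷ pos U ∷ pos v ∷ pos w ∷ pos q ∷ []
      pt : ℕ → ℕ
      pt = valuation xs
      fin : eval pt (cuspMerge-turning (side P) (side v) (side w)) ≡ true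
      fin = check-sound 5 (cuspMerge-turning (side P) (side v) (side w)) (cuspMerge-turning-holds (side P) (side v) (side w)) xs refl
      iU : suc m < suc (suc m)
      iU = ≤-refl
      i2 : 2 < suc (suc m)
      i2 = s≤s (s≤s (s≤s z≤n))
      ne : ∀ {a b : ℕ} → a ≢ b → suc a ≢ suc b
      ne h e = h (suc-injective e)
      Kne1 : length K ≢ 0
      Kne1 e = lem e K≠ where
        lem : ∀ {k} → k ≡ 0 → 1 ≤ k → ⊥
        lem refl ()
      Kne2 : suc (length K) ≢ 1
      Kne2 e = Kne1 (suc-injective e)
      m≢2 : suc (suc (length K)) ≢ 2
      m≢2 e = Kne1 (suc-injective (suc-injective e))
      neq : ∀ {x} → x ≢ suc x
      neq ()
      cond1 : ∀ {b} → b ≡ true → (eval pt (‵≢ 1 2) ∧ eval pt (‵≢ 2 3) ∧ eval pt (‵≢ 1 3) ∧ eval pt (‵≢ 0 1) ∧ eval pt (‵≢ 0 2) ∧ eval pt (‵≢ 0 3) ∧ eval pt (‵≢ 4 1) ∧ eval pt (‵≢ 4 2) ∧ eval pt (‵≢ 4 3) ∧ b) ≡ true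
      cond1 tl = ∧-i (‵≢-holds pt 1 2 (posne iU (s≤s z≤n) (λ ())))
             (∧-i (‵≢-holds pt 2 3 (posne {0} {1} (s≤s z≤n) (s≤s (s≤s z≤n)) (λ ())))
             (∧-i (‵≢-holds pt 1 3 (posne {suc m} {1} iU (s≤s (s≤s z≤n)) (ne (λ ()))))
             (∧-i (‵≢-holds pt 0 1 (posne {m} {suc m} (s≤s (n≤1+n _)) iU neq))
             (∧-i (‵≢-holds pt 0 2 (posne {m} {0} (s≤s (n≤1+n _)) (s≤s z≤n) (λ ())))
             (∧-i (‵≢-holds pt 0 3 (posne {m} {1} (s≤s (n≤1+n _)) (s≤s (s≤s z≤n)) Kne2))
             (∧-i (‵≢-holds pt 4 1 (posne {2} {suc m} i2 iU (λ e → m≢2 (sym e))))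
             (∧-i (‵≢-holds pt 4 2 (posne {2} {0} i2 (s≤s z≤n) (λ ())))
             (∧-i (‵≢-holds pt 4 3 (posne {2} {1} i2 (s≤s (s≤s z≤n)) (λ ()))) tl))))))))
      eok : All (IsEdgeOf pt L) ((0 , 1 , side P) ∷ (1 , 2 , side v) ∷ (2 , 3 , side v) ∷ (3 , 4 , side w) ∷ [])
      eok = record { index = m ; index< = s≤s (n≤1+n _) ; source≡ = refl ; target≡ = cong (λ z → pos (at L z)) (sym (Cyclic.next-suc (suc (suc m)) m ≤-refl)) ; side≡ = refl }
          ∷ record { index = suc m ; index< = iU ; source≡ = refl ; target≡ = cong (λ z → pos (at L z)) (sym nxL-last) ; side≡ = sym cusp }
          ∷ record { index = 0 ; index< = s≤s z≤n ; source≡ = refl ; target≡ = cong (λ z → pos (at L z)) (sym nxL-0) ; side≡ = refl }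
          ∷ record { index = 1 ; index< = s≤s (s≤s z≤n) ; target≡ = cong (λ z → pos (at L z)) (sym (Cyclic.next-suc (suc (suc m)) 1 i2)) ; source≡ = refl ; side≡ = refl }
          ∷ []
      concl = ≡ℤᵇ-sound (modusPonens fin (cond1 (‵pairwiseNonCrossing-holds pt L n _ eok)))
      Ueq : U ≡ (pos U , side v)
      Ueq = cong (pos U ,_) cusp

    totalTurning′ : totalTurning L ≡ totalTurning Z
    totalTurning′ = begin
      turn v w (pos q) ℤ.+ pathTurning (Z ++ v ∷ w ∷ [])
        ≡⟨ cong (ℤ._+_ (turn v w (pos q))) (pathTurning-close w q K v w) ⟩
      turn v w (pos q) ℤ.+ (pathTurning Z ℤ.+ (turn P U (pos v) ℤ.+ turn U v (pos w)))
        ≡⟨ rearrange (turn v w (pos q)) (pathTurning Z) (turn P U (pos v)) (turn U v (pos w)) ⟩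
      pathTurning Z ℤ.+ (turn P U (pos v) ℤ.+ (turn U v (pos w) ℤ.+ turn v w (pos q)))
        ≡⟨ cong (ℤ._+_ (pathTurning Z)) cusp-turns ⟩
      pathTurning Z ℤ.+ (turn P U (pos w) ℤ.+ turn U w (pos q))
        ≡⟨ pathTurning-close w q K w q ⟨
      totalTurning Z ∎
      where
      open ≡-Reasoning
      rearrange : ∀ (a M b c : ℤ) → a ℤ.+ (M ℤ.+ (b ℤ.+ c)) ≡ M ℤ.+ (b ℤ.+ (c ℤ.+ a))
      rearrange = solve-∀


≢⇒opposite : ∀ {x y} → x ≢ y → y ≡ opposite x
≢⇒opposite {st₁} {st₁} h = ⊥-elim (h refl)
≢⇒opposite {st₁} {st₂} h = refl
≢⇒opposite {st₂} {st₁} h = refl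
≢⇒opposite {st₂} {st₂} h = ⊥-elim (h refl)

opposite-involutive : ∀ x → opposite (opposite x) ≡ x
opposite-involutive st₁ = refl
opposite-involutive st₂ = refl

-- L alternates sides and no vertex lies between a and b; Z replaces the path
-- p→a→b→q by one arc p→q.
module EmptyArcRemoval (a b q k : Vertex) (K : List Vertex) where
  Z : List Vertex
  Z = q ∷ k ∷ K
  L : List Vertex
  L = a ∷ b ∷ Z
  m : ℕ
  m = suc (length K)
  NL : ℕ
  NL = suc (suc (suc m))
  pp : Vertex
  pp = at Z (length K)
  p : Vertex
  p = at Z m

  nxZ-old : ∀ t → suc t < suc m → next (suc m) t ≡ suc t
  nxZ-old t h = Cyclic.next-suc (suc m) t h
  nxZ-new : next (suc m) m ≡ 0
  nxZ-new = Cyclic.next-last (suc m) m refl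
  nxL : ∀ t → suc t < suc m → next NL (suc (suc t)) ≡ suc (suc (suc t))
  nxL t h = Cyclic.next-suc NL (suc (suc t)) (s≤s (s≤s h))
  nxL-last : next NL (suc (suc m)) ≡ 0
  nxL-last = Cyclic.next-last NL (suc (suc m)) refl
  nxL-0 : next NL 0 ≡ 1
  nxL-0 = Cyclic.next-suc NL 0 (s≤s (s≤s z≤n))
  nxL-1 : next NL 1 ≡ 2
  nxL-1 = Cyclic.next-suc NL 1 (s≤s (s≤s (s≤s z≤n)))
  nxL-m : next NL (suc m) ≡ suc (suc m)
  nxL-m = Cyclic.next-suc NL (suc m) ≤-refl

  distinct′ : DistinctPositions L → DistinctPositions Z
  distinct′ u t t' h h' e = suc-injective (suc-injective (u (suc (suc t)) (suc (suc t')) (s≤s (s≤s h)) (s≤s (s≤s h')) e))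

  split : ∀ t → t < suc m → suc t < suc m ⊎ t ≡ m
  split t h with suc t <? suc m
  ... | yes r = inj₁ r
  ... | no r = inj₂ (suc-injective (≤-antisym h (≮⇒≥ r)))

  module _ (u : DistinctPositions L) (n : NonCrossing L) (al : Alternating L)
           (emp : ∀ x → x < NL → between (pos (at L x)) (pos a) (pos b) ≡ false) (K≠ : 1 ≤ length K) where
    posne : ∀ {i j} → i < NL → j < NL → i ≢ j → pos (at L i) ≢ pos (at L j)
    posne h h' ne e = ne (u _ _ h h' e)
    iP : suc (suc m) < NL
    iP = ≤-refl
    s : Stack
    s = side a
    sp : side p ≡ opposite s
    sp = ≢⇒opposite (λ e → al (suc (suc m)) iP (trans (sym e) (cong (λ z → side (at L z)) (sym nxL-last))))
    sb : side b ≡ opposite s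
    sb = ≢⇒opposite (λ e → al 0 (s≤s z≤n) (trans e (cong (λ z → side (at L z)) (sym nxL-0))))
    sq : side q ≡ s
    sq = trans (≢⇒opposite (λ e → al 1 (s≤s (s≤s z≤n)) (trans e (cong (λ z → side (at L z)) (sym nxL-1))))) (trans (cong opposite sb) (opposite-involutive s))
    spp : side pp ≡ s
    spp = trans (≢⇒opposite (λ e → al (suc m) (s≤s (n≤1+n _)) (trans (sym e) (cong (λ z → side (at L z)) (sym nxL-m))))) (trans (cong opposite sp) (opposite-involutive s))
    i2 : 2 < NL
    i2 = s≤s (s≤s (s≤s z≤n))
    m≢0 : ∀ {x : ℕ} → suc x ≢ 0
    m≢0 ()
    neq2 : suc (suc m) ≢ 2
    neq2 e = m≢0 (suc-injective (suc-injective e))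
    dpa = posne {suc (suc m)} {0} iP (s≤s z≤n) (λ ())
    dpb = posne {suc (suc m)} {1} iP (s≤s (s≤s z≤n)) (λ e → m≢0 (suc-injective e))
    dpq = posne {suc (suc m)} {2} iP i2 neq2
    dab = posne {0} {1} (s≤s z≤n) (s≤s (s≤s z≤n)) (λ ())
    daq = posne {0} {2} (s≤s z≤n) i2 (λ ())
    dbq = posne {1} {2} (s≤s (s≤s z≤n)) i2 (λ ())

    newEdge-nonCrossing : ∀ t' → suc t' < suc m → side p ≡ side (at Z t') →
      (crosses (pos p) (pos q) (pos (at Z t')) (pos (at Z (suc t'))) ≡ false) × (crosses (pos (at Z t')) (pos (at Z (suc t'))) (pos p) (pos q) ≡ false)
    newEdge-nonCrossing t' h se = not-true (∧-l concl) , not-true (∧-r concl)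
      where
      xs : List ℕ
      xs = pos p ∷ pos a ∷ pos b ∷ pos q ∷ pos (at Z t') ∷ pos (at Z (suc t')) ∷ []
      pt : ℕ → ℕ
      pt = valuation xs
      fin : eval pt arcRemoval-nonCrossing ≡ true
      fin = check-sound 6 arcRemoval-nonCrossing arcRemoval-nonCrossing-holds xs refl
      it : suc (suc t') < NL
      it = s≤s (s≤s (≤-trans (n≤1+n _) h))
      it2 : suc (suc (suc t')) < NL
      it2 = s≤s (s≤s h)
      sbZ : side b ≡ side (at Z t')
      sbZ = trans sb (trans (sym sp) se)
      e1 = subst₂ (λ x y → crosses (pos p) (pos (at L x)) (pos (at Z t')) (pos (at L y)) ≡ false) nxL-last (nxL t' h)
             (n (suc (suc m)) (suc (suc t')) iP it se)
      e2 = subst₂ (λ x y → crosses (pos (at Z t')) (pos (at L y)) (pos p) (pos (at L x)) ≡ false) nxL-last (nxL t' h)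
             (n (suc (suc t')) (suc (suc m)) it iP (sym se))
      e3 = subst₂ (λ x y → crosses (pos b) (pos (at L x)) (pos (at Z t')) (pos (at L y)) ≡ false) nxL-1 (nxL t' h)
             (n 1 (suc (suc t')) (s≤s (s≤s z≤n)) it sbZ)
      e4 = subst₂ (λ x y → crosses (pos (at Z t')) (pos (at L y)) (pos b) (pos (at L x)) ≡ false) nxL-1 (nxL t' h)
             (n (suc (suc t')) 1 it (s≤s (s≤s z≤n)) (sym sbZ))
      nz : ∀ {x y : ℕ} → suc (suc x) ≢ 0
      nz ()
      no1 : ∀ {x : ℕ} → suc (suc x) ≢ 1
      no1 ()
      cond = ∧-i (‵≢-holds pt 0 1 dpa) (∧-i (‵≢-holds pt 0 2 dpb) (∧-i (‵≢-holds pt 0 3 dpq) (∧-i (‵≢-holds pt 1 2 dab) (∧-i (‵≢-holds pt 1 3 daq)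
             (∧-i (‵≢-holds pt 2 3 dbq) (∧-i (‵¬between-holds pt 4 1 2 (emp _ it)) (∧-i (‵¬between-holds pt 5 1 2 (emp _ it2))
             (∧-i (‵≢-holds pt 4 1 (posne it (s≤s z≤n) (nz {y = 0}))) (∧-i (‵≢-holds pt 4 2 (posne it (s≤s (s≤s z≤n)) no1))
             (∧-i (‵≢-holds pt 5 1 (posne it2 (s≤s z≤n) (nz {y = 0}))) (∧-i (‵≢-holds pt 5 2 (posne it2 (s≤s (s≤s z≤n)) no1))
             (∧-i (not-false e1) (∧-i (not-false e2) (∧-i (not-false e3) (not-false e4)))))))))))))))
      concl = modusPonens fin cond

    nonCrossing′ : NonCrossing Z
    nonCrossing′ t t' h h' se with split t h | split t' h'
    ... | inj₁ x | inj₁ y rewrite nxZ-old t x | nxZ-old t' y =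
      subst₂ (λ x' y' → crosses (pos (at Z t)) (pos (at L x')) (pos (at Z t')) (pos (at L y')) ≡ false) (nxL t x) (nxL t' y)
        (n (suc (suc t)) (suc (suc t')) (s≤s (s≤s h)) (s≤s (s≤s h')) se)
    ... | inj₂ refl | inj₁ y rewrite nxZ-new | nxZ-old t' y = proj₁ (newEdge-nonCrossing t' y se)
    ... | inj₁ x | inj₂ refl rewrite nxZ-new | nxZ-old t x = proj₂ (newEdge-nonCrossing t x (sym se))
    ... | inj₂ refl | inj₂ refl rewrite nxZ-new = crosses-self (pos p) (pos q)

    emptyArc-turns : turn pp p (pos a) ℤ.+ (turn p a (pos b) ℤ.+ (turn a b (pos q) ℤ.+ turn b q (pos k))) ≡ turn pp p (pos q) ℤ.+ turn p q (pos k)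
    emptyArc-turns = subst (λ PP → turn PP p (pos a) ℤ.+ (turn p a (pos b) ℤ.+ (turn a b (pos q) ℤ.+ turn b q (pos k))) ≡ turn PP p (pos q) ℤ.+ turn p q (pos k))
              (cong (pos pp ,_) (sym spp))
            (subst (λ P' → turn (pos pp , s) P' (pos a) ℤ.+ (turn P' a (pos b) ℤ.+ (turn a b (pos q) ℤ.+ turn b q (pos k))) ≡ turn (pos pp , s) P' (pos q) ℤ.+ turn P' q (pos k))
              (cong (pos p ,_) (sym sp))
            (subst (λ B → turn (pos pp , s) (pos p , opposite s) (pos a) ℤ.+ (turn (pos p , opposite s) a (pos b) ℤ.+ (turn a B (pos q) ℤ.+ turn B q (pos k))) ≡ turn (pos pp , s) (pos p , opposite s) (pos q) ℤ.+ turn (pos p , opposite s) q (pos k))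
              (cong (pos b ,_) (sym sb))
            (subst (λ Q → turn (pos pp , s) (pos p , opposite s) (pos a) ℤ.+ (turn (pos p , opposite s) a (pos b) ℤ.+ (turn a (pos b , opposite s) (pos Q) ℤ.+ turn (pos b , opposite s) Q (pos k))) ≡ turn (pos pp , s) (pos p , opposite s) (pos Q) ℤ.+ turn (pos p , opposite s) Q (pos k))
              (cong (pos q ,_) (sym sq))
              concl)))
      where
      xs : List ℕ
      xs = pos pp ∷ pos p ∷ pos a ∷ pos b ∷ pos q ∷ pos k ∷ []
      pt : ℕ → ℕ
      pt = valuation xs
      fin : eval pt (arcRemoval-turning s) ≡ true
      fin = check-sound 6 (arcRemoval-turning s) (arcRemoval-turning-holds s) xs refl
      e5 = subst (λ x → crosses (pos p) (pos (at L x)) (pos b) (pos q) ≡ false) nxL-last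
             (subst (λ y → crosses (pos p) (pos (at L (next NL (suc (suc m))))) (pos b) (pos (at L y)) ≡ false) nxL-1
               (n (suc (suc m)) 1 iP (s≤s (s≤s z≤n)) (trans sp (sym sb))))
      e6 = subst (λ x → crosses (pos b) (pos q) (pos p) (pos (at L x)) ≡ false) nxL-last
             (subst (λ y → crosses (pos b) (pos (at L y)) (pos p) (pos (at L (next NL (suc (suc m))))) ≡ false) nxL-1
               (n 1 (suc (suc m)) (s≤s (s≤s z≤n)) iP (trans sb (sym sp))))
      cond = ∧-i (‵≢-holds pt 1 2 dpa) (∧-i (‵≢-holds pt 1 3 dpb) (∧-i (‵≢-holds pt 1 4 dpq) (∧-i (‵≢-holds pt 2 3 dab) (∧-i (‵≢-holds pt 2 4 daq)
             (∧-i (‵≢-holds pt 3 4 dbq) (∧-i (‵¬between-holds pt 1 2 3 (emp _ iP)) (∧-i (‵¬between-holds pt 4 2 3 (emp 2 i2))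
             (∧-i (not-false e5) (not-false e6)))))))))
      concl = ≡ℤᵇ-sound (modusPonens fin cond)

    totalTurning′ : totalTurning L ≡ totalTurning Z
    totalTurning′ = begin
      turn a b (pos q) ℤ.+ (turn b q (pos k) ℤ.+ pathTurning (Z ++ a ∷ b ∷ []))
        ≡⟨ cong (λ z → turn a b (pos q) ℤ.+ (turn b q (pos k) ℤ.+ z)) (pathTurning-close q k K a b) ⟩
      turn a b (pos q) ℤ.+ (turn b q (pos k) ℤ.+ (pathTurning Z ℤ.+ (turn pp p (pos a) ℤ.+ turn p a (pos b))))
        ≡⟨ rearrange (turn a b (pos q)) (turn b q (pos k)) (pathTurning Z) (turn pp p (pos a)) (turn p a (pos b)) ⟩
      pathTurning Z ℤ.+ (turn pp p (pos a) ℤ.+ (turn p a (pos b) ℤ.+ (turn a b (pos q) ℤ.+ turn b q (pos k))))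
        ≡⟨ cong (ℤ._+_ (pathTurning Z)) emptyArc-turns ⟩
      pathTurning Z ℤ.+ (turn pp p (pos q) ℤ.+ turn p q (pos k))
        ≡⟨ pathTurning-close q k K q k ⟨
      totalTurning Z ∎
      where
      open ≡-Reasoning
      rearrange : ∀ (x y M c d : ℤ) → x ℤ.+ (y ℤ.+ (M ℤ.+ (c ℤ.+ d))) ≡ M ℤ.+ (c ℤ.+ (d ℤ.+ (x ℤ.+ y)))
      rearrange = solve-∀


_≟ˢ_ : (x y : Stack) → Dec (x ≡ y)
st₁ ≟ˢ st₁ = yes refl
st₂ ≟ˢ st₂ = yes refl
st₁ ≟ˢ st₂ = no (λ ())
st₂ ≟ˢ st₁ = no (λ ())

between-sound : ∀ {x a b} → between x a b ≡ true → (a < x × x < b) ⊎ (b < x × x < a)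
between-sound {x} {a} {b} h with lt a x in e1 | lt x b in e2 | lt b x in e3 | lt x a in e4
... | true | true | _ | _ = inj₁ (lt-sound e1 , lt-sound e2)
... | true | false | true | true = inj₂ (lt-sound e3 , lt-sound e4)
... | false | _ | true | true = inj₂ (lt-sound e3 , lt-sound e4)

between-left : ∀ a b → between a a b ≡ false
between-left a b with between a a b in e
... | false = refl
... | true with between-sound {a} {a} {b} e
... | inj₁ (p , _) = ⊥-elim (<-irrefl refl p)
... | inj₂ (_ , p) = ⊥-elim (<-irrefl refl p)

between-right : ∀ a b → between b a b ≡ false
between-right a b with between b a b in e
... | false = refl
... | true with between-sound {b} {a} {b} e
... | inj₁ (_ , p) = ⊥-elim (<-irrefl refl p)
... | inj₂ (p , _) = ⊥-elim (<-irrefl refl p)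

crosses-first : ∀ {a b c d} → between c a b ≡ true → between d a b ≡ false → d ≢ a → d ≢ b → crosses a b c d ≡ true
crosses-first {a} {b} {c} {d} h1 h2 n1 n2 rewrite h1 | h2 | same-false n1 | same-false n2 = refl

crosses-second : ∀ {a b c d} → between d a b ≡ true → between c a b ≡ false → c ≢ a → c ≢ b → crosses a b c d ≡ true
crosses-second {a} {b} {c} {d} h1 h2 n1 n2 rewrite h1 | h2 | same-false n1 | same-false n2 with between c a b ∧ outside d a b
... | true = refl
... | false = refl

inner0 : ∀ b x y → 0 < x → x < b → 0 < y → y < b → ∣ x - y ∣ < b
inner0 b (suc x) (suc y) _ xb _ yb = ≤-<-trans (∣m-n∣≤m⊔n x y) (⊔-lub' xb yb) where
  ⊔-lub' : suc x < b → suc y < b → x ⊔ y < b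
  ⊔-lub' p q = ⊔-lub (<-trans ≤-refl p) (<-trans ≤-refl q)

∣-∣-inside : ∀ a b x y → a < x → x < b → a < y → y < b → ∣ x - y ∣ < ∣ a - b ∣
∣-∣-inside zero b x y = inner0 b x y
∣-∣-inside (suc a) (suc b) (suc x) (suc y) (s≤s p) (s≤s q) (s≤s r) (s≤s s) = ∣-∣-inside a b x y p q r s

between⇒shorter : ∀ {a b x y} → between x a b ≡ true → between y a b ≡ true → ∣ x - y ∣ < ∣ a - b ∣
between⇒shorter {a} {b} {x} {y} hx hy with between-sound {x} {a} {b} hx | between-sound {y} {a} {b} hy
... | inj₁ (p , q) | inj₁ (r , s) = ∣-∣-inside a b x y p q r s
... | inj₂ (p , q) | inj₂ (r , s) = subst (∣ x - y ∣ <_) (∣-∣-comm b a) (∣-∣-inside b a x y p q r s)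
... | inj₁ (p , q) | inj₂ (r , s) = ⊥-elim (<-irrefl refl (<-trans p (<-trans q (<-trans r s))))
... | inj₂ (p , q) | inj₁ (r , s) = ⊥-elim (<-irrefl refl (<-trans p (<-trans q (<-trans r s))))

EmptyArc : List Vertex → ℕ → Set
EmptyArc L j = ∀ x → x < length L → between (pos (at L x)) (pos (at L j)) (pos (at L (next (length L) j))) ≡ false

module InnermostArc (L : List Vertex) (u : DistinctPositions L) (n : NonCrossing L) (al : Alternating L) where
  N : ℕ
  N = length L
  open Cyclic N
  span : ℕ → ℕ
  span j = ∣ pos (at L j) - pos (at L (next N j)) ∣

  posne : ∀ {i j} → i < N → j < N → i ≢ j → pos (at L i) ≢ pos (at L j)
  posne h h' ne e = ne (u _ _ h h' e)

  -- Of the two arcs at a vertex x below the arc j, the one on the side of j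
  -- lies below j, since arcs on one side do not cross.
  shorterArc : ∀ j x → j < N → x < N → between (pos (at L x)) (pos (at L j)) (pos (at L (next N j))) ≡ true →
               Σ ℕ λ j' → j' < N × span j' < span j
  shorterArc j x jN xN bx with side (at L x) ≟ˢ side (at L j)
  ... | yes sx = x , xN , between⇒shorter {a} {b} {X} {y} bx y-between
    where
    a b X y : ℕ
    a = pos (at L j)
    b = pos (at L (next N j))
    X = pos (at L x)
    y = pos (at L (next N x))
    y≢a : y ≢ a
    y≢a = posne (next< x xN) jN (λ e → al x xN (trans sx (cong (λ z → side (at L z)) (sym e))))
    y≢b : y ≢ b
    y≢b = posne (next< x xN) (next< j jN) (λ e → x≢j (next-injective x j xN jN e))
      where
      x≢j : x ≢ j
      x≢j refl with () ← trans (sym bx) (between-left a b)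
    y-between : between y a b ≡ true
    y-between with between y a b in e
    ... | true  = refl
    ... | false with () ← trans (sym (crosses-first {a} {b} {X} {y} bx e y≢a y≢b)) (n j x jN xN (sym sx))
  ... | no sx = w , wN , subst (_< span j) (trans (∣-∣-comm X y) (cong (λ z → ∣ y - pos (at L z) ∣) (sym nxw)))
                                  (between⇒shorter {a} {b} {X} {y} bx y-between)
    where
    a b X y w : ℕ
    a = pos (at L j)
    b = pos (at L (next N j))
    X = pos (at L x)
    w = prev N x
    y = pos (at L w)
    wN : w < N
    wN = prev< x xN
    nxw : next N w ≡ x
    nxw = next-prev x xN
    sw : side (at L w) ≡ side (at L j)
    sw = trans (sym (opposite-involutive _)) (trans (cong opposite (sym (≢⇒opposite (λ e → al w wN (trans e (cong (λ z → side (at L z)) (sym nxw)))))))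
           (sym (≢⇒opposite sx)))
    y≢a : y ≢ a
    y≢a = posne wN jN w≢j
      where
      w≢j : w ≢ j
      w≢j e with () ← trans (sym bx) (subst (λ z → between (pos (at L z)) a b ≡ false) (trans (sym (cong (next N) e)) nxw) (between-right a b))
    y≢b : y ≢ b
    y≢b = posne wN (next< j jN) (λ e → al j jN (sym (trans (cong (λ z → side (at L z)) (sym e)) sw)))
    y-between : between y a b ≡ true
    y-between with between y a b in e
    ... | true  = refl
    ... | false with () ← trans (sym (crosses-second {a} {b} {y} {X} bx e y≢a y≢b))
                                (subst (λ z → crosses a b y (pos (at L z)) ≡ false) nxw (n j w jN wN (sym sw)))

  emptyArc-below : ∀ f j → j < N → span j ≤ f → Σ ℕ λ j' → j' < N × EmptyArc L j'
  emptyArc-below f j jN sf with anyUpTo? (λ x → between (pos (at L x)) (pos (at L j)) (pos (at L (next N j))) Bool.≟ true) N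
  ... | no none = j , jN , λ x xN → ¬-not (λ bx → none (x , xN , bx))
  ... | yes (x , xN , bx) with shorterArc j x jN xN bx | f
  ...   | j' , j'N , shorter | zero  with () ← ≤-trans shorter sf
  ...   | j' , j'N , shorter | suc f = emptyArc-below f j' j'N (≤-pred (≤-trans shorter sf))

TotalTurning±2 : List Vertex → Set
TotalTurning±2 L = Is±2 (totalTurning L)

‵±2-sound : ∀ pt z → eval pt (‵±2 z) ≡ true → Is±2 (evalTurn pt z)
‵±2-sound pt z h with ∨-sound h
... | inj₁ e = inj₁ (≡ℤᵇ-sound e)
... | inj₂ e = inj₂ (≡ℤᵇ-sound e)

triangle-turning : ∀ x y z → DistinctPositions (x ∷ y ∷ z ∷ []) → TotalTurning±2 (x ∷ y ∷ z ∷ [])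
triangle-turning x y z u = ‵±2-sound pt (triangleTurning (side x) (side y) (side z)) (modusPonens fin cond)
  where
  xs : List ℕ
  xs = pos x ∷ pos y ∷ pos z ∷ []
  pt : ℕ → ℕ
  pt = valuation xs
  fin : eval pt (triangle-±2 (side x) (side y) (side z)) ≡ true
  fin = check-sound 3 (triangle-±2 (side x) (side y) (side z)) (triangle-±2-holds (side x) (side y) (side z)) xs refl
  d : ∀ i j → i < 3 → j < 3 → i ≢ j → pos (at (x ∷ y ∷ z ∷ []) i) ≢ pos (at (x ∷ y ∷ z ∷ []) j)
  d i j p q ne e = ne (u i j p q e)
  cond = ∧-i (‵≢-holds pt 0 1 (d 0 1 (s≤s z≤n) (s≤s (s≤s z≤n)) (λ ())))
         (∧-i (‵≢-holds pt 1 2 (d 1 2 (s≤s (s≤s z≤n)) (s≤s (s≤s (s≤s z≤n))) (λ ())))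
              (‵≢-holds pt 0 2 (d 0 2 (s≤s z≤n) (s≤s (s≤s (s≤s z≤n))) (λ ()))))

quadrilateral-turning : ∀ x y z w → DistinctPositions (x ∷ y ∷ z ∷ w ∷ []) → NonCrossing (x ∷ y ∷ z ∷ w ∷ []) → TotalTurning±2 (x ∷ y ∷ z ∷ w ∷ [])
quadrilateral-turning x y z w u n = ‵±2-sound pt (quadrilateralTurning (side x) (side y) (side z) (side w)) (modusPonens fin cond)
  where
  L = x ∷ y ∷ z ∷ w ∷ []
  xs : List ℕ
  xs = pos x ∷ pos y ∷ pos z ∷ pos w ∷ []
  pt : ℕ → ℕ
  pt = valuation xs
  fin : eval pt (quadrilateral-±2 (side x) (side y) (side z) (side w)) ≡ true
  fin = check-sound 4 (quadrilateral-±2 (side x) (side y) (side z) (side w)) (quadrilateral-±2-holds (side x) (side y) (side z) (side w)) xs refl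
  d : ∀ i j → i < 4 → j < 4 → i ≢ j → pos (at L i) ≢ pos (at L j)
  d i j p q ne e = ne (u i j p q e)
  l0 : 0 < 4
  l0 = s≤s z≤n
  l1 : 1 < 4
  l1 = s≤s (s≤s z≤n)
  l2 : 2 < 4
  l2 = s≤s (s≤s (s≤s z≤n))
  l3 : 3 < 4
  l3 = ≤-refl
  eok : All (IsEdgeOf pt L) ((0 , 1 , side x) ∷ (1 , 2 , side y) ∷ (2 , 3 , side z) ∷ (3 , 0 , side w) ∷ [])
  eok = record { index = 0 ; index< = l0 ; source≡ = refl ; target≡ = refl ; side≡ = refl }
      ∷ record { index = 1 ; index< = l1 ; source≡ = refl ; target≡ = refl ; side≡ = refl }
      ∷ record { index = 2 ; index< = l2 ; source≡ = refl ; target≡ = refl ; side≡ = refl }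
      ∷ record { index = 3 ; index< = l3 ; source≡ = refl ; target≡ = refl ; side≡ = refl } ∷ []
  cond = ∧-i (‵≢-holds pt 0 1 (d 0 1 l0 l1 (λ ()))) (∧-i (‵≢-holds pt 0 2 (d 0 2 l0 l2 (λ ()))) (∧-i (‵≢-holds pt 0 3 (d 0 3 l0 l3 (λ ())))
         (∧-i (‵≢-holds pt 1 2 (d 1 2 l1 l2 (λ ()))) (∧-i (‵≢-holds pt 1 3 (d 1 3 l1 l3 (λ ()))) (∧-i (‵≢-holds pt 2 3 (d 2 3 l2 l3 (λ ())))
         (‵pairwiseNonCrossing-holds pt L n _ eok))))))

record Reduction (L : List Vertex) : Set where
  field
    curve        : List Vertex
    shorter      : length curve < length L
    length≥3     : 3 ≤ length curve
    distinct     : DistinctPositions curve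
    nonCrossing  : NonCrossing curve
    sameTurning  : totalTurning L ≡ totalTurning curve

mergeCusp : ∀ R → 5 ≤ length R → DistinctPositions R → NonCrossing R → side (at R (pred (length R))) ≡ side (at R 0) → Reduction R
mergeCusp (_ ∷ [])             (s≤s ())                   _ _ _
mergeCusp (_ ∷ _ ∷ [])         (s≤s (s≤s ()))             _ _ _
mergeCusp (_ ∷ _ ∷ _ ∷ [])     (s≤s (s≤s (s≤s ())))       _ _ _
mergeCusp (v ∷ w ∷ q ∷ k ∷ K') _ u n c = record
  { curve = Z ; shorter = ≤-refl ; length≥3 = s≤s (s≤s (s≤s z≤n)) ; distinct = distinct′ u
  ; nonCrossing = nonCrossing′ u n c (s≤s z≤n) ; sameTurning = totalTurning′ u n c (s≤s z≤n) }
  where open CuspMerge v w q (k ∷ K')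

removeEmptyArc : ∀ R → 5 ≤ length R → DistinctPositions R → NonCrossing R → Alternating R →
                 (∀ x → x < length R → between (pos (at R x)) (pos (at R 0)) (pos (at R 1)) ≡ false) → Reduction R
removeEmptyArc (_ ∷ [])                 (s≤s ())                   _ _ _ _
removeEmptyArc (_ ∷ _ ∷ [])             (s≤s (s≤s ()))             _ _ _ _
removeEmptyArc (_ ∷ _ ∷ _ ∷ [])         (s≤s (s≤s (s≤s ())))       _ _ _ _
removeEmptyArc (_ ∷ _ ∷ _ ∷ _ ∷ [])     (s≤s (s≤s (s≤s (s≤s ())))) _ _ _ _
removeEmptyArc (a ∷ b ∷ q ∷ k ∷ k' ∷ K') _ u n al emp = record
  { curve = Z ; shorter = s≤s (n≤1+n _) ; length≥3 = s≤s (s≤s (s≤s z≤n)) ; distinct = distinct′ u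
  ; nonCrossing = nonCrossing′ u n al emp (s≤s z≤n) ; sameTurning = totalTurning′ u n al emp (s≤s z≤n) }
  where open EmptyArcRemoval a b q k (k' ∷ K')

reduction-rotate^ : ∀ j L → 3 ≤ length L → Reduction (rotate^ j L) → Reduction L
reduction-rotate^ j L L≥3 r = record
  { curve = curve ; shorter = subst (length curve <_) (length-rotate^ j L) shorter
  ; length≥3 = length≥3 ; distinct = distinct ; nonCrossing = nonCrossing
  ; sameTurning = trans (sym (totalTurning-rotate^ j L L≥3)) sameTurning }
  where open Reduction r

prev-next : ∀ N j → j < N → prev N (next N j) ≡ j
prev-next N j p = Cyclic.next-injective N _ _ (Cyclic.prev< N _ (Cyclic.next< N j p)) p (Cyclic.next-prev N _ (Cyclic.next< N j p))

-- Rotate a cusp, if there is one, to the front and merge it; otherwise the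
-- curve alternates sides, and an empty arc is rotated to the front and removed.
reduce : ∀ L → 5 ≤ length L → DistinctPositions L → NonCrossing L → Reduction L
reduce L l5 u n with anyUpTo? (λ j → side (at L j) ≟ˢ side (at L (next (length L) j))) (length L)
... | yes (j , jN , c) =
  reduction-rotate^ r L L≥3
    (mergeCusp R (subst (5 ≤_) (sym (length-rotate^ r L)) l5) (Rotation.distinct L u r) (Rotation.nonCrossing L n r) cuspR)
  where
  N : ℕ
  N = length L
  N0 : 0 < N
  N0 = ≤-trans (s≤s z≤n) l5
  L≥3 : 3 ≤ N
  L≥3 = ≤-trans (s≤s (s≤s (s≤s z≤n))) l5
  r : ℕ
  r = next N j
  rN : r < N
  rN = Cyclic.next< N j jN
  R : List Vertex
  R = rotate^ r L
  open Shift N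
  cuspR : side (at R (pred (length R))) ≡ side (at R 0)
  cuspR rewrite length-rotate^ r L =
    trans (cong side (at-rotate^ r L (pred N) refl (Cyclic.prev< N 0 N0)))
   (trans (cong (λ z → side (at L z)) (trans (shift-prev r 0 N0) (trans (cong (prev N) (shift-zero r rN)) (prev-next N j jN))))
   (trans c (sym (cong side (trans (at-rotate^ r L 0 refl N0) (cong (at L) (shift-zero r rN)))))))
... | no noCusp =
  reduction-rotate^ j' L L≥3
    (removeEmptyArc R (subst (5 ≤_) (sym (length-rotate^ j' L)) l5) (Rotation.distinct L u j') (Rotation.nonCrossing L n j')
      (Rotation.alternating L alternating j') empR)
  where
  N : ℕ
  N = length L
  N0 : 0 < N
  N0 = ≤-trans (s≤s z≤n) l5
  L≥3 : 3 ≤ N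
  L≥3 = ≤-trans (s≤s (s≤s (s≤s z≤n))) l5
  alternating : Alternating L
  alternating t tN c = noCusp (t , tN , c)
  open InnermostArc L u n alternating using (emptyArc-below; span)
  d : Σ ℕ λ j' → j' < N × EmptyArc L j'
  d = emptyArc-below (span 0) 0 N0 ≤-refl
  j' = proj₁ d
  j'N = proj₁ (proj₂ d)
  R : List Vertex
  R = rotate^ j' L
  open Shift N
  at0 : at R 0 ≡ at L j'
  at0 = trans (at-rotate^ j' L 0 refl N0) (cong (at L) (shift-zero j' j'N))
  at1 : at R 1 ≡ at L (next N j')
  at1 = trans (at-rotate^ j' L 1 refl (≤-trans (s≤s (s≤s z≤n)) l5))
          (cong (at L) (trans (cong (shift N j') (sym (Cyclic.next-suc N 0 (≤-trans (s≤s (s≤s z≤n)) l5))))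
                        (trans (shift-next j' 0) (cong (next N) (shift-zero j' j'N)))))
  empR : ∀ x → x < length R → between (pos (at R x)) (pos (at R 0)) (pos (at R 1)) ≡ false
  empR x xR rewrite at0 | at1 | length-rotate^ j' L | at-rotate^ j' L x refl xR = proj₂ (proj₂ d) (shift N j' x) (shift< j' x xR)

simpleCurve-turning : ∀ L → 3 ≤ length L → DistinctPositions L → NonCrossing L → TotalTurning±2 L
simpleCurve-turning L = bySize (length L) L ≤-refl
  where
  bySize : ∀ bound L → length L ≤ bound → 3 ≤ length L → DistinctPositions L → NonCrossing L → TotalTurning±2 L
  bySize _ (_ ∷ [])                  _ (s≤s ())       _ _
  bySize _ (_ ∷ _ ∷ [])              _ (s≤s (s≤s ())) _ _
  bySize _ (x ∷ y ∷ z ∷ [])          _ _ u n = triangle-turning x y z u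
  bySize _ (x ∷ y ∷ z ∷ w ∷ [])      _ _ u n = quadrilateral-turning x y z w u n
  bySize zero        (_ ∷ _ ∷ _ ∷ _ ∷ _ ∷ _) () _ _ _
  bySize (suc bound) L@(_ ∷ _ ∷ _ ∷ _ ∷ _ ∷ _) L≤ _ u n =
    Sum.map (trans sameTurning) (trans sameTurning)
      (bySize bound curve (≤-pred (≤-trans shorter L≤)) length≥3 distinct nonCrossing)
    where open Reduction (reduce L (s≤s (s≤s (s≤s (s≤s (s≤s z≤n))))) u n)

-- Nesting depth

depthStep : Stack → Kind → ℤ
depthStep st₁ (call st₁) = + 1
depthStep st₂ (call st₂) = + 1
depthStep st₁ (ret st₁) = -[1+ 0 ]
depthStep st₂ (ret st₂) = -[1+ 0 ]
depthStep st₁ (call st₂) = + 0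
depthStep st₂ (call st₁) = + 0
depthStep st₁ (ret st₂) = + 0
depthStep st₂ (ret st₁) = + 0
depthStep _ int = + 0

depthStep-call : ∀ s → depthStep s (call s) ≡ + 1
depthStep-call st₁ = refl
depthStep-call st₂ = refl
depthStep-ret : ∀ s → depthStep s (ret s) ≡ -[1+ 0 ]
depthStep-ret st₁ = refl
depthStep-ret st₂ = refl
depthStep-other : ∀ s k → k ≢ call s → k ≢ ret s → depthStep s k ≡ + 0
depthStep-other st₁ (call st₁) h h' = ⊥-elim (h refl)
depthStep-other st₂ (call st₂) h h' = ⊥-elim (h refl)
depthStep-other st₁ (ret st₁) h h' = ⊥-elim (h' refl)
depthStep-other st₂ (ret st₂) h h' = ⊥-elim (h' refl)
depthStep-other st₁ (call st₂) h h' = refl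
depthStep-other st₂ (call st₁) h h' = refl
depthStep-other st₁ (ret st₂) h h' = refl
depthStep-other st₂ (ret st₁) h h' = refl
depthStep-other st₁ int h h' = refl
depthStep-other st₂ int h h' = refl

take-++ : ∀ {X : Set} n (u v : List X) → take n (u ++ v) ≡ take n u ++ take (n ∸ length u) v
take-++ zero [] v = refl
take-++ zero (x ∷ u) v = refl
take-++ (suc n) [] v = refl
take-++ (suc n) (x ∷ u) v = cong (x ∷_) (take-++ n u v)

take-+ : ∀ {X : Set} a n (l : List X) → take (a + n) l ≡ take a l ++ take n (drop a l)
take-+ zero n l = refl
take-+ (suc a) n [] = sym (take-[] n)
take-+ (suc a) n (x ∷ l) = cong (x ∷_) (take-+ a n l)

+-cancelˡ-≤ℤ : ∀ x {a b} → x ℤ.+ a ≤ℤ x ℤ.+ b → a ≤ℤ b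
+-cancelˡ-≤ℤ x {a} {b} h = subst₂ _≤ℤ_ (cancel x a) (cancel x b) (ℤP.+-monoʳ-≤ (ℤ.- x) h)
  where cancel : ∀ x y → ℤ.- x ℤ.+ (x ℤ.+ y) ≡ y
        cancel = solve-∀

1ℤ≰-1ℤ : ¬ 1ℤ ≤ℤ -1ℤ
1ℤ≰-1ℤ ()

0ℤ≰-1ℤ : ¬ 0ℤ ≤ℤ -1ℤ
0ℤ≰-1ℤ ()

1ℤ≰0ℤ : ¬ 1ℤ ≤ℤ 0ℤ
1ℤ≰0ℤ (ℤ.+≤+ ())

module Depth (A : Alphabet) where
  open Alphabet A

  depthOf : Stack → List (Letter A) → ℤ
  depthOf s [] = + 0
  depthOf s (x ∷ u) = depthStep s (kind x) ℤ.+ depthOf s u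

  depthOf-++ : ∀ s u v → depthOf s (u ++ v) ≡ depthOf s u ℤ.+ depthOf s v
  depthOf-++ s [] v = sym (ℤP.+-identityˡ _)
  depthOf-++ s (x ∷ u) v = trans (cong (λ z → depthStep s (kind x) ℤ.+ z) (depthOf-++ s u v)) (sym (ℤP.+-assoc (depthStep s (kind x)) _ _))

  Balanced : Stack → List (Letter A) → Set
  Balanced s u = depthOf s u ≡ + 0 × (∀ n → + 0 ≤ℤ depthOf s (take n u))

  -1≤depth-single : ∀ s b → kind b ≡ ret s → ∀ k → -[1+ 0 ] ≤ℤ depthOf s (take k [ b ])
  -1≤depth-single s b kb zero = ℤ.-≤+
  -1≤depth-single s b kb (suc k) rewrite kb | depthStep-ret s | take-[] {A = Letter A} k = ℤP.≤-refl

  wellFormed⇒balanced : ∀ {s u} → WellFormed A s u → Balanced s u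
  wellFormed⇒balanced {s} (wf-nest {a} {b} {u} ka w kb) = tot , pre
    where
    g : Balanced s u
    g = wellFormed⇒balanced w
    tot : depthOf s (a ∷ (u ++ [ b ])) ≡ + 0
    tot rewrite ka | depthStep-call s | depthOf-++ s u [ b ] | proj₁ g | kb | depthStep-ret s = refl
    pre : ∀ n → + 0 ≤ℤ depthOf s (take n (a ∷ (u ++ [ b ])))
    pre zero = ℤP.≤-refl
    pre (suc n) rewrite ka | depthStep-call s | take-++ n u [ b ] | depthOf-++ s (take n u) (take (n ∸ length u) [ b ]) =
      ℤP.≤-trans (ℤP.≤-reflexive (sym lem)) (ℤP.+-monoʳ-≤ (+ 1) (ℤP.+-mono-≤ (proj₂ g n) (-1≤depth-single s b kb (n ∸ length u))))
      where lem : + 1 ℤ.+ (+ 0 ℤ.+ -[1+ 0 ]) ≡ + 0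
            lem = refl
  wellFormed⇒balanced {s} (wf-cat {u} {v} w w') = tot , pre
    where
    g : Balanced s u
    g = wellFormed⇒balanced w
    g' : Balanced s v
    g' = wellFormed⇒balanced w'
    tot : depthOf s (u ++ v) ≡ + 0
    tot rewrite depthOf-++ s u v | proj₁ g | proj₁ g' = refl
    pre : ∀ n → + 0 ≤ℤ depthOf s (take n (u ++ v))
    pre n rewrite take-++ n u v | depthOf-++ s (take n u) (take (n ∸ length u) v) =
      ℤP.+-mono-≤ (proj₂ g n) (proj₂ g' (n ∸ length u))
  wellFormed⇒balanced {s} wf-eps = refl , λ { zero → ℤP.≤-refl ; (suc n) → ℤP.≤-refl }
  wellFormed⇒balanced {s} (wf-other {c} h h') = tot , pre
    where
    tot : depthOf s [ c ] ≡ + 0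
    tot rewrite depthStep-other s (kind c) h h' = refl
    pre : ∀ n → + 0 ≤ℤ depthOf s (take n [ c ])
    pre zero = ℤP.≤-refl
    pre (suc n) rewrite depthStep-other s (kind c) h h' | take-[] {A = Letter A} n = ℤP.≤-refl

  -- If (i , j) ∈ μˢ, the s-depth rises by one just after i, stays at least as
  -- high up to j and falls back just after j; two such profiles can neither
  -- interleave nor share an endpoint.
  module DepthIn (W : NestedWord A) (s : Stack) where
    lbl : List (Letter A)
    lbl = NestedWord.labels W
    depthAt : ℕ → ℤ
    depthAt p = depthOf s (take p lbl)

    depth-+ : ∀ a n → depthAt (a + n) ≡ depthAt a ℤ.+ depthOf s (take n (drop a lbl))
    depth-+ a n = trans (cong (depthOf s) (take-+ a n lbl)) (depthOf-++ s (take a lbl) _)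

    lab⇒drop : ∀ (l : List (Letter A)) p {x} → lab A l p ≡ just x → drop p l ≡ x ∷ drop (suc p) l
    lab⇒drop (y ∷ l) zero refl = refl
    lab⇒drop (y ∷ l) (suc p) h = lab⇒drop l p h

    depth-suc : ∀ p {x} → lab A lbl p ≡ just x → depthAt (suc p) ≡ depthAt p ℤ.+ depthStep s (kind x)
    depth-suc p {x} h = begin
      depthAt (suc p)                                 ≡⟨ cong depthAt (+-comm 1 p) ⟩
      depthAt (p + 1)                                 ≡⟨ depth-+ p 1 ⟩
      depthAt p ℤ.+ depthOf s (take 1 (drop p lbl))   ≡⟨ cong (λ l → depthAt p ℤ.+ depthOf s (take 1 l)) (lab⇒drop lbl p h) ⟩
      depthAt p ℤ.+ (depthStep s (kind x) ℤ.+ 0ℤ)     ≡⟨ cong (ℤ._+_ (depthAt p)) (ℤP.+-identityʳ _) ⟩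
      depthAt p ℤ.+ depthStep s (kind x)              ∎
      where open ≡-Reasoning

    record MatchDepths (i j : ℕ) : Set where
      field
        i<j : i < j
        depth-call : depthAt (suc i) ≡ depthAt i ℤ.+ + 1
        depth-return : depthAt (suc j) ≡ depthAt j ℤ.+ -[1+ 0 ]
        depth-match : depthAt j ≡ depthAt (suc i)
        depth-inside : ∀ p → suc i ≤ p → p ≤ j → depthAt (suc i) ≤ℤ depthAt p

    matchDepths : ∀ {i j} → Mu^ A s W i j → MatchDepths i j
    matchDepths {i} {j} (i<j , (a , la , ka) , (b , lb , kb) , w) = record
      { i<j = i<j
      ; depth-call = trans (depth-suc i la) (trans (cong (λ k → depthAt i ℤ.+ depthStep s k) ka) (cong (ℤ._+_ (depthAt i)) (depthStep-call s)))
      ; depth-return = trans (depth-suc j lb) (trans (cong (λ k → depthAt j ℤ.+ depthStep s k) kb) (cong (ℤ._+_ (depthAt j)) (depthStep-ret s)))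
      ; depth-match = trans (cong depthAt (sym (m+[n∸m]≡n i<j))) (trans (depth-+ (suc i) (j ∸ suc i)) (trans (cong (λ z → depthAt (suc i) ℤ.+ z) (proj₁ g)) (ℤP.+-identityʳ _)))
      ; depth-inside = mid }
      where
      seg : List (Letter A)
      seg = take (j ∸ suc i) (drop (suc i) lbl)
      g : Balanced s seg
      g = wellFormed⇒balanced w
      mid : ∀ p → suc i ≤ p → p ≤ j → depthAt (suc i) ≤ℤ depthAt p
      mid p ip pj = subst (λ q → depthAt (suc i) ≤ℤ depthAt q) (m+[n∸m]≡n ip)
         (subst (depthAt (suc i) ≤ℤ_) (sym (depth-+ (suc i) (p ∸ suc i)))
           (subst (λ z → depthAt (suc i) ≤ℤ depthAt (suc i) ℤ.+ depthOf s z) tk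
             (ℤP.≤-trans (ℤP.≤-reflexive (sym (ℤP.+-identityʳ _))) (ℤP.+-monoʳ-≤ (depthAt (suc i)) (proj₂ g (p ∸ suc i))))))
        where
        tk : take (p ∸ suc i) seg ≡ take (p ∸ suc i) (drop (suc i) lbl)
        tk = trans (take-take (p ∸ suc i) (j ∸ suc i) (drop (suc i) lbl))
                   (cong (λ k → take k (drop (suc i) lbl)) (m≤n⇒m⊓n≡m (∸-monoˡ-≤ (suc i) pj)))

    μ-noInterleaving : ∀ {i j i' j'} → Mu^ A s W i j → Mu^ A s W i' j' → i < i' → i' < j → j < j' → ⊥
    μ-noInterleaving {i} {j} {i'} {j'} m m' ii' i'j jj' = 1ℤ≰-1ℤ (+-cancelˡ-≤ℤ (depthAt (suc i)) chain)
      where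
      f = matchDepths m
      f' = matchDepths m'
      chain : depthAt (suc i) ℤ.+ + 1 ≤ℤ depthAt (suc i) ℤ.+ -[1+ 0 ]
      chain = ℤP.≤-trans (ℤP.+-monoˡ-≤ (+ 1) (MatchDepths.depth-inside f i' ii' (<⇒≤ i'j)))
             (ℤP.≤-trans (ℤP.≤-reflexive (sym (MatchDepths.depth-call f')))
             (ℤP.≤-trans (MatchDepths.depth-inside f' (suc j) (+-monoʳ-≤ 1 (<⇒≤ i'j)) jj')
             (ℤP.≤-reflexive (trans (MatchDepths.depth-return f) (cong (λ z → z ℤ.+ -[1+ 0 ]) (MatchDepths.depth-match f))))))

    μ-functional< : ∀ {i j j'} → Mu^ A s W i j → Mu^ A s W i j' → j < j' → ⊥
    μ-functional< {i} {j} {j'} m m' jj' =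
      0ℤ≰-1ℤ (+-cancelˡ-≤ℤ (depthAt (suc i)) (subst (_≤ℤ depthAt (suc i) ℤ.+ -1ℤ) (sym (ℤP.+-identityʳ _)) chain))
      where
      f = matchDepths m
      f' = matchDepths m'
      chain : depthAt (suc i) ≤ℤ depthAt (suc i) ℤ.+ -[1+ 0 ]
      chain = ℤP.≤-trans (MatchDepths.depth-inside f' (suc j) (+-monoʳ-≤ 1 (<⇒≤ (MatchDepths.i<j f))) jj')
              (ℤP.≤-reflexive (trans (MatchDepths.depth-return f) (cong (λ z → z ℤ.+ -[1+ 0 ]) (MatchDepths.depth-match f))))

    μ-injective< : ∀ {i i' j} → Mu^ A s W i j → Mu^ A s W i' j → i < i' → ⊥
    μ-injective< {i} {i'} {j} m m' ii' =
      1ℤ≰0ℤ (+-cancelˡ-≤ℤ (depthAt (suc i)) (subst (depthAt (suc i) ℤ.+ 1ℤ ≤ℤ_) (sym (ℤP.+-identityʳ _)) chain))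
      where
      f = matchDepths m
      f' = matchDepths m'
      chain : depthAt (suc i) ℤ.+ + 1 ≤ℤ depthAt (suc i)
      chain = ℤP.≤-trans (ℤP.+-monoˡ-≤ (+ 1) (MatchDepths.depth-inside f i' ii' (<⇒≤ (MatchDepths.i<j f'))))
              (ℤP.≤-reflexive (trans (sym (MatchDepths.depth-call f')) (trans (sym (MatchDepths.depth-match f')) (MatchDepths.depth-match f))))

-- The curve drawn by a circular path

-- Steps are drawn as half-circles: ⟶ and ⟵ as unit half-circles in the upper
-- half-plane, a ±ₛ step as the half-circle over its μ-edge in half-plane s.
sideOf : Dir → Stack
sideOf right     = st₁
sideOf left      = st₁
sideOf (plus s)  = s
sideOf (minus s) = s

parity : Stack → ℤ
parity st₁ = 0ℤ
parity st₂ = 1ℤ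

parityPair : Dir → Dir → ℤ
parityPair e e' = parity (sideOf e) ℤ.+ parity (sideOf e')

halfTurn : Dir → Dir → ℤ
halfTurn _           (minus st₂) = -1ℤ
halfTurn right       (minus st₁) = 1ℤ
halfTurn left        (plus st₁)  = -1ℤ
halfTurn (plus st₂)  right       = -1ℤ
halfTurn (plus st₂)  (plus st₂)  = -1ℤ
halfTurn (minus st₂) right       = -1ℤ
halfTurn (minus st₂) (plus st₂)  = -1ℤ
halfTurn _           _           = 0ℤ

-- The turn between two consecutive steps only depends on their directions
-- (localTurn-correct); it is written so that its parity is visible.
localTurn : Dir → Dir → ℤ
localTurn e e' = parityPair e e' ℤ.+ + 2 ℤ.* halfTurn e e'

-- The step leads from point i to point j; no point, in particular not k, lies
-- strictly inside a unit step.
‵direction : Dir → ℕ → ℕ → ℕ → Formula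
‵direction right i j k = ‵lt i j ‵∧ ‵¬ (‵between k i j)
‵direction left i j k = ‵lt j i ‵∧ ‵¬ (‵between k i j)
‵direction (plus _) i j k = ‵lt i j
‵direction (minus _) i j k = ‵lt j i

-- Two consecutive ±-steps of a path would either return to where they
-- started or meet in a position that is both a call and a return.
‵notTwoArcs : Dir → Dir → Formula
‵notTwoArcs right _     = ‵true
‵notTwoArcs left  _     = ‵true
‵notTwoArcs _     right = ‵true
‵notTwoArcs _     left  = ‵true
‵notTwoArcs _     _     = ‵false

localTurn-correct : Dir → Dir → Formula
localTurn-correct e e' = (‵notTwoArcs e e' ‵∧ ‵≢ 0 1 ‵∧ ‵≢ 1 2 ‵∧ ‵≢ 0 2 ‵∧ ‵direction e 0 1 2 ‵∧ ‵direction e' 1 2 0)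
  ‵⇒ ‵turn 0 (sideOf e) 1 (sideOf e') 2 ‵≡ ‵int (localTurn e e')

localTurn-correct-holds : ∀ e e' → HoldsUpTo 3 (localTurn-correct e e') ≡ true
localTurn-correct-holds right right = refl
localTurn-correct-holds right left = refl
localTurn-correct-holds right (plus st₁) = refl
localTurn-correct-holds right (minus st₁) = refl
localTurn-correct-holds right (plus st₂) = refl
localTurn-correct-holds right (minus st₂) = refl
localTurn-correct-holds left right = refl
localTurn-correct-holds left left = refl
localTurn-correct-holds left (plus st₁) = refl
localTurn-correct-holds left (minus st₁) = refl
localTurn-correct-holds left (plus st₂) = refl
localTurn-correct-holds left (minus st₂) = refl
localTurn-correct-holds (plus st₁) right = refl
localTurn-correct-holds (plus st₁) left = refl
localTurn-correct-holds (plus st₁) (plus st₁) = refl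
localTurn-correct-holds (plus st₁) (minus st₁) = refl
localTurn-correct-holds (plus st₁) (plus st₂) = refl
localTurn-correct-holds (plus st₁) (minus st₂) = refl
localTurn-correct-holds (minus st₁) right = refl
localTurn-correct-holds (minus st₁) left = refl
localTurn-correct-holds (minus st₁) (plus st₁) = refl
localTurn-correct-holds (minus st₁) (minus st₁) = refl
localTurn-correct-holds (minus st₁) (plus st₂) = refl
localTurn-correct-holds (minus st₁) (minus st₂) = refl
localTurn-correct-holds (plus st₂) right = refl
localTurn-correct-holds (plus st₂) left = refl
localTurn-correct-holds (plus st₂) (plus st₁) = refl
localTurn-correct-holds (plus st₂) (minus st₁) = refl
localTurn-correct-holds (plus st₂) (plus st₂) = refl
localTurn-correct-holds (plus st₂) (minus st₂) = refl
localTurn-correct-holds (minus st₂) right = refl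
localTurn-correct-holds (minus st₂) left = refl
localTurn-correct-holds (minus st₂) (plus st₁) = refl
localTurn-correct-holds (minus st₂) (minus st₁) = refl
localTurn-correct-holds (minus st₂) (plus st₂) = refl
localTurn-correct-holds (minus st₂) (minus st₂) = refl

unitArc-nonCrossing : Formula
unitArc-nonCrossing = (‵¬ (‵between 2 0 1) ‵∧ ‵¬ (‵between 3 0 1)) ‵⇒ (‵¬ (‵crosses 0 1 2 3) ‵∧ ‵¬ (‵crosses 2 3 0 1))
unitArc-nonCrossing-holds : HoldsUpTo 4 unitArc-nonCrossing ≡ true
unitArc-nonCrossing-holds = refl

‵interleaved : ℕ → ℕ → ℕ → ℕ → Formula
‵interleaved x y z w = ‵lt x y ‵∧ ‵lt y z ‵∧ ‵lt z w

range : ℕ → ℕ → List ℕ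
range a zero = []
range a (suc n) = a ∷ range (suc a) n

sumRange : (ℕ → ℤ) → ℕ → ℕ → ℤ
sumRange F a zero = + 0
sumRange F a (suc n) = F a ℤ.+ sumRange F (suc a) n

pathTurning-range : ∀ (g : ℕ → Vertex) a M → pathTurning (map g (range a (suc (suc M)))) ≡ sumRange (λ t → turn (g t) (g (suc t)) (pos (g (suc (suc t))))) a M
pathTurning-range g a zero = refl
pathTurning-range g a (suc M) = cong (λ z → turn (g a) (g (suc a)) (pos (g (suc (suc a)))) ℤ.+ z) (pathTurning-range g (suc a) M)

adjacentSum : (Dir → Dir → ℤ) → List Dir → ℤ
adjacentSum f [] = + 0
adjacentSum f (x ∷ []) = + 0
adjacentSum f (x ∷ y ∷ r) = f x y ℤ.+ adjacentSum f (y ∷ r)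

cyclicSum : (Dir → Dir → ℤ) → List Dir → ℤ
cyclicSum f w = adjacentSum f (w ++ take 1 w)

adjacentSum-range : ∀ f (dd : ℕ → Dir) a M → adjacentSum f (map dd (range a (suc M))) ≡ sumRange (λ t → f (dd t) (dd (suc t))) a M
adjacentSum-range f dd a zero = refl
adjacentSum-range f dd a (suc M) = cong (λ z → f (dd a) (dd (suc a)) ℤ.+ z) (adjacentSum-range f dd (suc a) M)

sumRange-cong : ∀ F G a M → (∀ t → a ≤ t → t < a + M → F t ≡ G t) → sumRange F a M ≡ sumRange G a M
sumRange-cong F G a zero h = refl
sumRange-cong F G a (suc M) h =
  cong₂ ℤ._+_ (h a ≤-refl (m<m+n a (s≤s z≤n)))
              (sumRange-cong F G (suc a) M (λ t p q → h t (≤-trans (n≤1+n a) p) (subst (t <_) (sym (+-suc a M)) q)))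

range-+ : ∀ a m n → range a (m + n) ≡ range a m ++ range (a + m) n
range-+ a zero n = cong (λ z → range z n) (sym (+-identityʳ a))
range-+ a (suc m) n = cong (a ∷_) (trans (range-+ (suc a) m n) (cong (λ z → range (suc a) m ++ range z n) (sym (+-suc a m))))

map-cong-range : ∀ {X : Set} (f g : ℕ → X) a n → (∀ t → a ≤ t → t < a + n → f t ≡ g t) → map f (range a n) ≡ map g (range a n)
map-cong-range f g a zero h = refl
map-cong-range f g a (suc n) h =
  cong₂ _∷_ (h a ≤-refl (m<m+n a (s≤s z≤n)))
            (map-cong-range f g (suc a) n (λ t p q → h t (≤-trans (n≤1+n a) p) (subst (t <_) (sym (+-suc a n)) q)))

length-map-range : ∀ {X : Set} (g : ℕ → X) a n → length (map g (range a n)) ≡ n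
length-map-range g a zero = refl
length-map-range g a (suc n) = cong suc (length-map-range g (suc a) n)

at-map-range : ∀ (g : ℕ → Vertex) a n t → t < n → at (map g (range a n)) t ≡ g (a + t)
at-map-range g a (suc n) zero p = cong g (sym (+-identityʳ a))
at-map-range g a (suc n) (suc t) (s≤s p) = trans (at-map-range g (suc a) n t p) (cong g (sym (+-suc a t)))

-- t modulo N, for t < 2N.
wrap : ℕ → ℕ → ℕ
wrap N t with t <? N
... | yes _ = t
... | no _ = t ∸ N

wrap-< : ∀ N t → t < N → wrap N t ≡ t
wrap-< N t p with t <? N
... | yes _ = refl
... | no q = ⊥-elim (q p)

wrap-≥ : ∀ N t → N ≤ t → wrap N t ≡ t ∸ N
wrap-≥ N t p with t <? N
... | yes q = ⊥-elim (<-irrefl refl (≤-trans q p))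
... | no _ = refl

wrap-+ : ∀ N k → wrap N (N + k) ≡ k
wrap-+ N k = trans (wrap-≥ N (N + k) (m≤m+n N k)) (m+n∸m≡n N k)

-- The closed curve through the points sq 0, …, sq (N-1), leaving sq t by step lkd t.
module CurveOf (N : ℕ) (N2 : 2 ≤ N) (sq : ℕ → ℕ) (lkd : ℕ → Dir) where
  g : ℕ → Vertex
  g t = (sq t , sideOf (lkd t))
  g' : ℕ → Vertex
  g' t = g (wrap N t)
  dd : ℕ → Dir
  dd t = lkd (wrap N t)
  curve : List Vertex
  curve = map g (range 0 N)

  length-curve : length curve ≡ N
  length-curve = length-map-range g 0 N

  at-curve : ∀ t → t < N → at curve t ≡ g t
  at-curve t p = at-map-range g 0 N t p

  take2-map : ∀ N → 2 ≤ N → take 2 (map g (range 0 N)) ≡ g 0 ∷ g 1 ∷ []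
  take2-map (suc zero) (s≤s ())
  take2-map (suc (suc N)) _ = refl

  curve-closed : curve ++ take 2 curve ≡ map g' (range 0 (N + 2))
  curve-closed = sym (trans (cong (map g') (range-+ 0 N 2)) (trans (map-++ g' (range 0 N) (range N 2))
    (cong₂ _++_ (map-cong-range g' g 0 N (λ t _ q → cong g (wrap-< N t q)))
      (trans (cong₂ (λ x y → x ∷ y ∷ []) (cong g (trans (cong (wrap N) (sym (+-identityʳ N))) (wrap-+ N 0))) (cong g (trans (cong (wrap N) (sym (+-comm N 1))) (trans (wrap-+ N 1) refl))))
        (sym (take2-map N N2))))))

  totalTurning-range : totalTurning curve ≡ sumRange (λ t → turn (g' t) (g' (suc t)) (pos (g' (suc (suc t))))) 0 N
  totalTurning-range = trans (cong pathTurning curve-closed) (trans (cong (λ n → pathTurning (map g' (range 0 n))) (+-comm N 2)) (pathTurning-range g' 0 N))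

-- Beyond the end of the list the junk direction ⟶ is returned.
lookupDir : List Dir → ℕ → Dir
lookupDir []       _       = right
lookupDir (x ∷ xs) zero    = x
lookupDir (x ∷ xs) (suc t) = lookupDir xs t

map-lookupDir : ∀ (xs : List Dir) a → map (λ t → lookupDir xs (t ∸ a)) (range a (length xs)) ≡ xs
map-lookupDir []       a = refl
map-lookupDir (x ∷ xs) a = cong₂ _∷_ (cong (lookupDir (x ∷ xs)) (n∸n≡0 a))
  (trans (map-cong-range _ _ (suc a) (length xs) (λ t a<t _ → lookupDir-∸ t a<t)) (map-lookupDir xs (suc a)))
  where
  lookupDir-∸ : ∀ t → suc a ≤ t → lookupDir (x ∷ xs) (t ∸ a) ≡ lookupDir xs (t ∸ suc a)
  lookupDir-∸ t a<t with t ∸ a in e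
  ... | zero  = ⊥-elim (<⇒≱ a<t (m∸n≡0⇒m≤n e))
  ... | suc r = cong (lookupDir xs) (trans (sym (cong pred e)) (pred[m∸n]≡m∸[1+n] t a))

lookup≡lookupDir : ∀ (xs : List Dir) (k : Fin (length xs)) → lookup xs k ≡ lookupDir xs (toℕ k)
lookup≡lookupDir (x ∷ xs) Fin.zero    = refl
lookup≡lookupDir (x ∷ xs) (Fin.suc k) = lookup≡lookupDir xs k

module DirectionLookup (D : List Dir) where
  map-lookupDir-range : map (lookupDir D) (range 0 (length D)) ≡ D
  map-lookupDir-range = map-lookupDir D 0

  cyclicExtension : ∀ N → length D ≡ N → 1 ≤ N → D ++ take 1 D ≡ map (λ t → lookupDir D (wrap N t)) (range 0 (suc N))
  cyclicExtension N e N1 = sym (trans (cong (map dd') (trans (cong (range 0) (+-comm 1 N)) (range-+ 0 N 1)))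
      (trans (map-++ dd' (range 0 N) (range N 1))
      (cong₂ _++_ (trans (map-cong-range dd' (lookupDir D) 0 N (λ t _ q → cong (lookupDir D) (wrap-< N t q))) (subst (λ n → map (lookupDir D) (range 0 n) ≡ D) e map-lookupDir-range))
                  (trans (cong (λ z → lookupDir D z ∷ []) (trans (cong (wrap N) (sym (+-identityʳ N))) (wrap-+ N 0))) (sym (take1 D N e N1))))))
    where
    dd' : ℕ → Dir
    dd' t = lookupDir D (wrap N t)
    take1 : ∀ D N → length D ≡ N → 1 ≤ N → take 1 D ≡ lookupDir D 0 ∷ []
    take1 (x ∷ D) N  e    N1 = refl
    take1 []      .0 refl ()

  cyclicSum-range : ∀ f N → length D ≡ N → 1 ≤ N →
                    cyclicSum f D ≡ sumRange (λ t → f (lookupDir D (wrap N t)) (lookupDir D (wrap N (suc t)))) 0 N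
  cyclicSum-range f N e N1 = trans (cong (adjacentSum f) (cyclicExtension N e N1)) (adjacentSum-range f (λ t → lookupDir D (wrap N t)) 0 N)

just-injective : ∀ {X : Set} {a b : X} → just a ≡ just b → a ≡ b
just-injective refl = refl

call-injective : ∀ {s s'} → Kind.call s ≡ call s' → s ≡ s'
call-injective refl = refl
ret-injective : ∀ {s s'} → Kind.ret s ≡ ret s' → s ≡ s'
ret-injective refl = refl

module PathGeometry (A : Alphabet) (W : NestedWord A) where
  open Depth A
  call-unique : ∀ {s s' x} → IsCall A W s x → IsCall A W s' x → s ≡ s'
  call-unique (a , la , ka) (a' , la' , ka') with just-injective (trans (sym la) la')
  ... | refl = call-injective (trans (sym ka) ka')
  ret-unique : ∀ {s s' x} → IsRet A W s x → IsRet A W s' x → s ≡ s'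
  ret-unique (a , la , ka) (a' , la' , ka') with just-injective (trans (sym la) la')
  ... | refl = ret-injective (trans (sym ka) ka')
  call≢ret : ∀ {s s' x} → IsCall A W s x → IsRet A W s' x → ⊥
  call≢ret (a , la , ka) (a' , la' , ka') with just-injective (trans (sym la) la')
  ... | refl with () ← trans (sym ka) ka'

  plus⇒μ : ∀ {s u v} → Step A W (plus s) u v → Mu^ A s W u v
  plus⇒μ (c , s' , m) with call-unique c (proj₁ (proj₂ m))
  ... | refl = m
  minus⇒μ : ∀ {s u v} → Step A W (minus s) u v → Mu^ A s W v u
  minus⇒μ (r , s' , m) with ret-unique r (proj₁ (proj₂ (proj₂ m)))
  ... | refl = m

  μ-functional : ∀ {s i j j'} → Mu^ A s W i j → Mu^ A s W i j' → j ≡ j'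
  μ-functional {s} {i} {j} {j'} m m' with <-cmp j j'
  ... | tri< p _ _ = ⊥-elim (DepthIn.μ-functional< W s m m' p)
  ... | tri≈ _ e _ = e
  ... | tri> _ _ p = ⊥-elim (DepthIn.μ-functional< W s m' m p)

  μ-injective : ∀ {s i i' j} → Mu^ A s W i j → Mu^ A s W i' j → i ≡ i'
  μ-injective {s} {i} {i'} m m' with <-cmp i i'
  ... | tri< p _ _ = ⊥-elim (DepthIn.μ-injective< W s m m' p)
  ... | tri≈ _ e _ = e
  ... | tri> _ _ p = ⊥-elim (DepthIn.μ-injective< W s m' m p)

  no-two-arcs : ∀ {e e' u v w} → Step A W e u v → Step A W e' v w → u ≢ w → eval (valuation (u ∷ v ∷ w ∷ [])) (‵notTwoArcs e e') ≡ true
  no-two-arcs {right} s1 s2 ne = refl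
  no-two-arcs {left} s1 s2 ne = refl
  no-two-arcs {plus _} {right} s1 s2 ne = refl
  no-two-arcs {plus _} {left} s1 s2 ne = refl
  no-two-arcs {minus _} {right} s1 s2 ne = refl
  no-two-arcs {minus _} {left} s1 s2 ne = refl
  no-two-arcs {plus s} {plus s'} (c , _ , m) (c' , _) ne = ⊥-elim (call≢ret c' (proj₁ (proj₂ (proj₂ m))))
  no-two-arcs {minus s} {minus s'} (r , _ , m) (r' , _) ne = ⊥-elim (call≢ret (proj₁ (proj₂ m)) r')
  no-two-arcs {plus s} {minus s'} s1 s2 ne with plus⇒μ s1 | minus⇒μ s2
  ... | m | m' with ret-unique (proj₁ (proj₂ (proj₂ m))) (proj₁ (proj₂ (proj₂ m')))
  ... | refl = ⊥-elim (ne (μ-injective m m'))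
  no-two-arcs {minus s} {plus s'} s1 s2 ne with minus⇒μ s1 | plus⇒μ s2
  ... | m | m' with call-unique (proj₁ (proj₂ m)) (proj₁ (proj₂ m'))
  ... | refl = ⊥-elim (ne (μ-functional m m'))

  between-adjacent : ∀ c a → between c a (suc a) ≡ false
  between-adjacent c a with between c a (suc a) in e
  ... | false = refl
  ... | true with between-sound {c} {a} {suc a} e
  ... | inj₁ (p , q) = ⊥-elim (<-irrefl refl (≤-trans q p))
  ... | inj₂ (p , q) = ⊥-elim (<-irrefl refl (<-trans q (≤-trans (n≤1+n _) p)))

  between-sym : ∀ x a b → between x a b ≡ between x b a
  between-sym x a b with lt a x | lt x b | lt b x | lt x a
  ... | true | true | true | true = refl
  ... | true | true | true | false = refl
  ... | true | true | false | true = refl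
  ... | true | true | false | false = refl
  ... | true | false | true | true = refl
  ... | true | false | true | false = refl
  ... | true | false | false | _ = refl
  ... | false | true | true | true = refl
  ... | false | true | true | false = refl
  ... | false | true | false | _ = refl
  ... | false | false | true | true = refl
  ... | false | false | true | false = refl
  ... | false | false | false | _ = refl

  ‵direction-holds : ∀ {e u v} (x : ℕ) pt i j k → pt i ≡ u → pt j ≡ v → pt k ≡ x → Step A W e u v → eval pt (‵direction e i j k) ≡ true
  ‵direction-holds {right} {u} x pt i j k ei ej ek st rewrite ei | ej | ek | st = ∧-i (lt-true {u} {suc u} ≤-refl) (not-false (between-adjacent x u))
  ‵direction-holds {left} {u} {v} x pt i j k ei ej ek st rewrite ei | ej | ek | st = ∧-i (lt-true {v} {suc v} ≤-refl) (not-false (trans (between-sym x (suc v) v) (between-adjacent x v)))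
  ‵direction-holds {plus s} x pt i j k ei ej ek st rewrite ei | ej = lt-true (proj₁ (plus⇒μ st))
  ‵direction-holds {minus s} x pt i j k ei ej ek st rewrite ei | ej = lt-true (proj₁ (minus⇒μ st))

  turn≡localTurn : ∀ e e' u v w → Step A W e u v → Step A W e' v w → u ≢ v → v ≢ w → u ≢ w →
         turn (u , sideOf e) (v , sideOf e') w ≡ localTurn e e'
  turn≡localTurn e e' u v w s1 s2 n1 n2 n3 = ≡ℤᵇ-sound (modusPonens fin cond)
    where
    xs : List ℕ
    xs = u ∷ v ∷ w ∷ []
    pt : ℕ → ℕ
    pt = valuation xs
    fin : eval pt (localTurn-correct e e') ≡ true
    fin = check-sound 3 (localTurn-correct e e') (localTurn-correct-holds e e') xs refl
    cond = ∧-i (no-two-arcs s1 s2 n3) (∧-i (‵≢-holds pt 0 1 n1) (∧-i (‵≢-holds pt 1 2 n2) (∧-i (‵≢-holds pt 0 2 n3)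
           (∧-i (‵direction-holds w pt 0 1 2 refl refl refl s1) (‵direction-holds u pt 1 2 0 refl refl refl s2)))))

  notInterleaved : ∀ {s lo hi lo' hi'} → Mu^ A s W lo hi → Mu^ A s W lo' hi' → (lt lo lo' ∧ lt lo' hi ∧ lt hi hi') ≡ false
  notInterleaved {s} {lo} {hi} {lo'} {hi'} m m' with lt lo lo' in e1 | lt lo' hi in e2 | lt hi hi' in e3
  ... | false | _ | _ = refl
  ... | true | false | _ = refl
  ... | true | true | false = refl
  ... | true | true | true = ⊥-elim (DepthIn.μ-noInterleaving W s m m' (lt-sound e1) (lt-sound e2) (lt-sound e3))

ordered : Bool → ℕ → ℕ → ℕ × ℕ
ordered true i j = i , j
ordered false i j = j , i

nestedArcs-nonCrossing : Bool → Bool → Formula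
nestedArcs-nonCrossing o1 o2 = (‵lt (proj₁ p) (proj₂ p) ‵∧ ‵lt (proj₁ q) (proj₂ q) ‵∧ ‵¬ (‵interleaved (proj₁ p) (proj₁ q) (proj₂ p) (proj₂ q)) ‵∧ ‵¬ (‵interleaved (proj₁ q) (proj₁ p) (proj₂ q) (proj₂ p)))
  ‵⇒ (‵¬ (‵crosses 0 1 2 3) ‵∧ ‵¬ (‵crosses 2 3 0 1))
  where p = ordered o1 0 1
        q = ordered o2 2 3

nestedArcs-nonCrossing-holds : ∀ o1 o2 → HoldsUpTo 4 (nestedArcs-nonCrossing o1 o2) ≡ true
nestedArcs-nonCrossing-holds true true = refl
nestedArcs-nonCrossing-holds true false = refl
nestedArcs-nonCrossing-holds false true = refl
nestedArcs-nonCrossing-holds false false = refl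

module EdgeNonCrossing (A : Alphabet) (W : NestedWord A) where
  open PathGeometry A W
  open Depth A

  record NestedArc (s : Stack) (a b : ℕ) : Set where
    field
      o : Bool
      mu : Mu^ A s W (proj₁ (ordered o a b)) (proj₂ (ordered o a b))

  plus-arc : ∀ {s a b} → Step A W (plus s) a b → NestedArc s a b
  plus-arc st = record { o = true ; mu = plus⇒μ st }
  minus-arc : ∀ {s a b} → Step A W (minus s) a b → NestedArc s a b
  minus-arc st = record { o = false ; mu = minus⇒μ st }

  nestedArcs-disjoint : ∀ {s a b c d} → NestedArc s a b → NestedArc s c d → crosses a b c d ≡ false
  nestedArcs-disjoint {s} {a} {b} {c} {d} r r' = not-true (∧-l (modusPonens fin cond))
    where
    o1 : Bool
    o1 = NestedArc.o r
    o2 : Bool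
    o2 = NestedArc.o r'
    xs : List ℕ
    xs = a ∷ b ∷ c ∷ d ∷ []
    pt : ℕ → ℕ
    pt = valuation xs
    fin : eval pt (nestedArcs-nonCrossing o1 o2) ≡ true
    fin = check-sound 4 (nestedArcs-nonCrossing o1 o2) (nestedArcs-nonCrossing-holds o1 o2) xs refl
    cond : eval pt ((‵lt (proj₁ (ordered o1 0 1)) (proj₂ (ordered o1 0 1)) ‵∧ ‵lt (proj₁ (ordered o2 2 3)) (proj₂ (ordered o2 2 3)) ‵∧
            ‵¬ (‵interleaved (proj₁ (ordered o1 0 1)) (proj₁ (ordered o2 2 3)) (proj₂ (ordered o1 0 1)) (proj₂ (ordered o2 2 3))) ‵∧
            ‵¬ (‵interleaved (proj₁ (ordered o2 2 3)) (proj₁ (ordered o1 0 1)) (proj₂ (ordered o2 2 3)) (proj₂ (ordered o1 0 1))))) ≡ true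
    cond with o1 | o2 | NestedArc.mu r | NestedArc.mu r'
    ... | true | true | m | m' = ∧-i (lt-true (proj₁ m)) (∧-i (lt-true (proj₁ m')) (∧-i (not-false (notInterleaved m m')) (not-false (notInterleaved m' m))))
    ... | true | false | m | m' = ∧-i (lt-true (proj₁ m)) (∧-i (lt-true (proj₁ m')) (∧-i (not-false (notInterleaved m m')) (not-false (notInterleaved m' m))))
    ... | false | true | m | m' = ∧-i (lt-true (proj₁ m)) (∧-i (lt-true (proj₁ m')) (∧-i (not-false (notInterleaved m m')) (not-false (notInterleaved m' m))))
    ... | false | false | m | m' = ∧-i (lt-true (proj₁ m)) (∧-i (lt-true (proj₁ m')) (∧-i (not-false (notInterleaved m m')) (not-false (notInterleaved m' m))))

  right-empty : ∀ {a b} → Step A W right a b → ∀ x → between x a b ≡ false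
  right-empty {a} refl x = between-adjacent x a
  left-empty : ∀ {a b} → Step A W left a b → ∀ x → between x a b ≡ false
  left-empty {a} {b} refl x = trans (between-sym x (suc b) b) (between-adjacent x b)

  unitArc-disjoint : ∀ {a b} c d → (∀ x → between x a b ≡ false) → (crosses a b c d ≡ false) × (crosses c d a b ≡ false)
  unitArc-disjoint {a} {b} c d u = not-true (∧-l concl) , not-true (∧-r concl)
    where
    xs : List ℕ
    xs = a ∷ b ∷ c ∷ d ∷ []
    pt : ℕ → ℕ
    pt = valuation xs
    concl = modusPonens (check-sound 4 unitArc-nonCrossing unitArc-nonCrossing-holds xs refl) (∧-i (not-false (u c)) (not-false (u d)))

  edges-disjoint : ∀ e e' a b c d → Step A W e a b → Step A W e' c d → sideOf e ≡ sideOf e' → crosses a b c d ≡ false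
  edges-disjoint right e' a b c d st st' se = proj₁ (unitArc-disjoint c d (right-empty st))
  edges-disjoint left e' a b c d st st' se = proj₁ (unitArc-disjoint c d (left-empty st))
  edges-disjoint (plus s) right a b c d st st' se = proj₂ (unitArc-disjoint a b (right-empty st'))
  edges-disjoint (plus s) left a b c d st st' se = proj₂ (unitArc-disjoint a b (left-empty st'))
  edges-disjoint (minus s) right a b c d st st' se = proj₂ (unitArc-disjoint a b (right-empty st'))
  edges-disjoint (minus s) left a b c d st st' se = proj₂ (unitArc-disjoint a b (left-empty st'))
  edges-disjoint (plus s) (plus s') a b c d st st' refl = nestedArcs-disjoint (plus-arc st) (plus-arc st')
  edges-disjoint (plus s) (minus s') a b c d st st' refl = nestedArcs-disjoint (plus-arc st) (minus-arc st')
  edges-disjoint (minus s) (plus s') a b c d st st' refl = nestedArcs-disjoint (minus-arc st) (plus-arc st')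
  edges-disjoint (minus s) (minus s') a b c d st st' refl = nestedArcs-disjoint (minus-arc st) (minus-arc st')


module CurveOfPath (A : Alphabet) (D : List Dir) (W : NestedWord A) (i : ℕ) (R : Reach A W D i i) (N3 : 3 ≤ length D) where
  N : ℕ
  N = length D
  N2 : 2 ≤ N
  N2 = ≤-trans (n≤1+n _) N3
  N1 : 1 ≤ N
  N1 = ≤-trans (n≤1+n _) N2
  seq : Fin (suc N) → ℕ
  seq = proj₁ R
  start : seq Fin.zero ≡ i
  start = proj₁ (proj₂ (proj₂ R))
  end : seq (fromℕ N) ≡ i
  end = proj₁ (proj₂ (proj₂ (proj₂ R)))
  seq-injective : (k l : Fin N) → seq (inject₁ k) ≡ seq (inject₁ l) → k ≡ l
  seq-injective = proj₁ (proj₂ (proj₂ (proj₂ (proj₂ R))))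
  steps : (k : Fin N) → Step A W (lookup D k) (seq (inject₁ k)) (seq (Fin.suc k))
  steps = proj₂ (proj₂ (proj₂ (proj₂ (proj₂ (proj₂ R)))))

  toFin : ℕ → Fin (suc N)
  toFin t with t <? suc N
  ... | yes p = fromℕ< p
  ... | no _ = Fin.zero

  toℕ-toFin : ∀ t → t < suc N → toℕ (toFin t) ≡ t
  toℕ-toFin t p with t <? suc N
  ... | yes q = toℕ-fromℕ< q
  ... | no q = ⊥-elim (q p)

  position : ℕ → ℕ
  position t = seq (toFin t)

  direction : ℕ → Dir
  direction = lookupDir D

  step : ∀ t → t < N → Step A W (direction t) (position t) (position (suc t))
  step t p = subst₂ (λ x y → Step A W (direction t) (seq x) (seq y)) e1 e2 (subst (λ d → Step A W d (seq (inject₁ k)) (seq (Fin.suc k))) e3 (steps k))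
    where
    k = fromℕ< p
    e1 : inject₁ k ≡ toFin t
    e1 = toℕ-injective (trans (toℕ-inject₁ k) (trans (toℕ-fromℕ< p) (sym (toℕ-toFin t (≤-trans p (n≤1+n _))))))
    e2 : Fin.suc k ≡ toFin (suc t)
    e2 = toℕ-injective (trans (cong suc (toℕ-fromℕ< p)) (sym (toℕ-toFin (suc t) (s≤s p))))
    e3 : lookup D k ≡ direction t
    e3 = trans (lookup≡lookupDir D k) (cong direction (toℕ-fromℕ< p))

  positions-distinct : ∀ t t' → t < N → t' < N → position t ≡ position t' → t ≡ t'
  positions-distinct t t' p p' e = trans (sym (toℕ-fromℕ< p)) (trans (cong toℕ kk) (toℕ-fromℕ< p'))
    where
    k = fromℕ< p
    k' = fromℕ< p'
    e1 : ∀ {t} (p : t < N) → inject₁ (fromℕ< p) ≡ toFin t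
    e1 {t} p = toℕ-injective (trans (toℕ-inject₁ (fromℕ< p)) (trans (toℕ-fromℕ< p) (sym (toℕ-toFin t (≤-trans p (n≤1+n _))))))
    kk : k ≡ k'
    kk = seq-injective k k' (trans (cong seq (e1 p)) (trans e (cong seq (sym (e1 p')))))

  closed : position N ≡ position 0
  closed = trans (cong seq (toℕ-injective (trans (toℕ-toFin N ≤-refl) (sym (toℕ-fromℕ N))))) (trans end (trans (sym start) (cong seq (toℕ-injective (sym (toℕ-toFin 0 (s≤s z≤n)))))))

  open Cyclic N
  position-next : ∀ t → t < N → position (next N t) ≡ position (suc t)
  position-next t p with suc t <? N
  ... | yes q = refl
  ... | no q = trans (sym closed) (cong position (≤-antisym (≮⇒≥ q) p))

  step-next : ∀ t → t < N → Step A W (direction t) (position t) (position (next N t))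
  step-next t p = subst (Step A W (direction t) (position t)) (sym (position-next t p)) (step t p)

  open CurveOf N N2 position direction public

  curve-distinct : DistinctPositions curve
  curve-distinct t t' p p' e = positions-distinct t t' (subst (t <_) length-curve p) (subst (t' <_) length-curve p')
    (trans (sym (cong pos (at-curve t (subst (t <_) length-curve p)))) (trans e (cong pos (at-curve t' (subst (t' <_) length-curve p')))))

  curve-nonCrossing : NonCrossing curve
  curve-nonCrossing t t' p p' se rewrite length-curve | at-curve t p | at-curve t' p' | at-curve (next N t) (next< t p) | at-curve (next N t') (next< t' p') =
    EdgeNonCrossing.edges-disjoint A W (direction t) (direction t') _ _ _ _ (step-next t p) (step-next t' p') se

  wrap-suc : ∀ t → t < N → wrap N (suc t) ≡ next N t
  wrap-suc t p with suc t ≟ N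
  ... | yes e = trans (wrap-≥ N (suc t) (≤-reflexive (sym e))) (trans (cong (_∸ N) e) (trans (n∸n≡0 N) (sym (next-last t e))))
  ... | no ne = trans (wrap-< N (suc t) q) (sym (next-suc t q))
    where q = ≤∧≢⇒< p ne

  wrap-suc² : ∀ t → t < N → wrap N (suc (suc t)) ≡ next N (next N t)
  wrap-suc² t p with suc t ≟ N
  ... | yes e rewrite next-last t e = trans (cong (λ z → wrap N (suc z)) e) (trans (cong (wrap N) (+-comm 1 N)) (trans (wrap-+ N 1) (sym (next-suc 0 N2))))
  ... | no ne rewrite next-suc t (≤∧≢⇒< p ne) = wrap-suc (suc t) (≤∧≢⇒< p ne)

  2+n≢n : ∀ {n : ℕ} → suc (suc n) ≢ n
  2+n≢n ()

  t≢next : ∀ t → t < N → t ≢ next N t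
  t≢next t p with suc t <? N
  ... | yes q = λ e → 1+n≢n (sym e)
  ... | no q = λ e → lem e (≤-antisym p (≮⇒≥ q)) where
    lem : t ≡ 0 → suc t ≡ N → ⊥
    lem refl e = case (subst (3 ≤_) (sym e) N3) where
      case : 3 ≤ 1 → ⊥
      case (s≤s ())

  t≢next² : ∀ t → t < N → t ≢ next N (next N t)
  t≢next² t p with suc t <? N
  ... | no q = λ e → lem (trans e (next-suc 0 N2)) (≤-antisym p (≮⇒≥ q)) where
    lem : t ≡ 1 → suc t ≡ N → ⊥
    lem refl e = case (subst (3 ≤_) (sym e) N3) where
      case : 3 ≤ 2 → ⊥
      case (s≤s (s≤s ()))
  ... | yes q with suc (suc t) <? N
  ...   | yes r = λ e → 2+n≢n (sym e)
  ...   | no r = λ e → lem e (≤-antisym q (≮⇒≥ r)) where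
    lem : t ≡ 0 → suc (suc t) ≡ N → ⊥
    lem refl e = case (subst (3 ≤_) (sym e) N3) where
      case : 3 ≤ 2 → ⊥
      case (s≤s (s≤s ()))

  turn-window : ∀ t → t < N → turn (g' t) (g' (suc t)) (pos (g' (suc (suc t)))) ≡ localTurn (direction (wrap N t)) (direction (wrap N (suc t)))
  turn-window t p rewrite wrap-< N t p | wrap-suc t p | wrap-suc² t p =
    PathGeometry.turn≡localTurn A W (direction t) (direction t′) (position t) (position t′) (position t″) (step-next t p) (step-next t′ t′<N)
      (λ e → t≢next t p (positions-distinct _ _ p t′<N e))
      (λ e → t≢next t′ t′<N (positions-distinct _ _ t′<N (next< t′ t′<N) e))
      (λ e → t≢next² t p (positions-distinct _ _ p (next< t′ t′<N) e))
    where
    t′ t″ : ℕ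
    t′ = next N t
    t″ = next N t′
    t′<N : t′ < N
    t′<N = next< t p

  totalTurning≡cyclicSum : totalTurning curve ≡ cyclicSum localTurn D
  totalTurning≡cyclicSum = trans totalTurning-range (trans (sumRange-cong _ _ 0 N (λ t _ q → turn-window t q)) (sym (DirectionLookup.cyclicSum-range D localTurn N refl N1)))

  curve-length : 3 ≤ length curve
  curve-length = subst (3 ≤_) (sym length-curve) N3

-- Turning of powers

last′ : Dir → List Dir → Dir
last′ x []      = x
last′ x (z ∷ Z) = last′ z Z

last′-snoc : ∀ x X y → last′ x (X ++ y ∷ []) ≡ y
last′-snoc x []      y = refl
last′-snoc x (z ∷ Z) y = last′-snoc z Z y

adjacentSum-++ : ∀ f x X y Y →
                 adjacentSum f ((x ∷ X) ++ (y ∷ Y)) ≡ adjacentSum f (x ∷ X) ℤ.+ f (last′ x X) y ℤ.+ adjacentSum f (y ∷ Y)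
adjacentSum-++ f x []      y Y = cong (ℤ._+ adjacentSum f (y ∷ Y)) (sym (ℤP.+-identityˡ (f x y)))
adjacentSum-++ f x (z ∷ Z) y Y = trans (cong (ℤ._+_ (f x z)) (adjacentSum-++ f z Z y Y)) (reassoc (f x z) (adjacentSum f (z ∷ Z)) _ _)
  where reassoc : ∀ a b c d → a ℤ.+ (b ℤ.+ c ℤ.+ d) ≡ a ℤ.+ b ℤ.+ c ℤ.+ d
        reassoc = solve-∀

adjacentSum-+ : ∀ F G l → adjacentSum (λ x y → F x y ℤ.+ G x y) l ≡ adjacentSum F l ℤ.+ adjacentSum G l
adjacentSum-+ F G []          = refl
adjacentSum-+ F G (x ∷ [])    = refl
adjacentSum-+ F G (x ∷ y ∷ l) =
  trans (cong (ℤ._+_ (F x y ℤ.+ G x y)) (adjacentSum-+ F G (y ∷ l)))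
        (interchange (F x y) (G x y) (adjacentSum F (y ∷ l)) (adjacentSum G (y ∷ l)))
  where interchange : ∀ a b c d → a ℤ.+ b ℤ.+ (c ℤ.+ d) ≡ a ℤ.+ c ℤ.+ (b ℤ.+ d)
        interchange = solve-∀

adjacentSum-2* : ∀ H l → adjacentSum (λ x y → + 2 ℤ.* H x y) l ≡ + 2 ℤ.* adjacentSum H l
adjacentSum-2* H []          = refl
adjacentSum-2* H (x ∷ [])    = refl
adjacentSum-2* H (x ∷ y ∷ l) =
  trans (cong (ℤ._+_ (+ 2 ℤ.* H x y)) (adjacentSum-2* H (y ∷ l))) (sym (ℤP.*-distribˡ-+ (+ 2) (H x y) _))

cyclicSum-∷ : ∀ f e w' → cyclicSum f (e ∷ w') ≡ adjacentSum f (e ∷ w') ℤ.+ f (last′ e w') e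
cyclicSum-∷ f e w' = trans (adjacentSum-++ f e w' e []) (ℤP.+-identityʳ _)

+suc-* : ∀ n c → + suc n ℤ.* c ≡ c ℤ.+ + n ℤ.* c
+suc-* n c = trans (ℤP.*-distribʳ-+ c (+ 1) (+ n)) (cong (ℤ._+ + n ℤ.* c) (ℤP.*-identityˡ c))

cyclicSum-pow : ∀ f e w' k → cyclicSum f (pow (e ∷ w') (suc k)) ≡ + suc k ℤ.* cyclicSum f (e ∷ w')
cyclicSum-pow f e w' zero = trans (cong (λ l → adjacentSum f (l ++ e ∷ [])) (++-identityʳ (e ∷ w'))) (sym (ℤP.*-identityˡ _))
cyclicSum-pow f e w' (suc k) = begin
  adjacentSum f (((e ∷ w') ++ P) ++ e ∷ [])       ≡⟨ cong (adjacentSum f) (++-assoc (e ∷ w') P (e ∷ [])) ⟩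
  adjacentSum f ((e ∷ w') ++ (P ++ e ∷ []))       ≡⟨ adjacentSum-++ f e w' e ((w' ++ pow (e ∷ w') k) ++ e ∷ []) ⟩
  adjacentSum f (e ∷ w') ℤ.+ f (last′ e w') e ℤ.+ cyclicSum f P
                                                  ≡⟨ cong₂ ℤ._+_ (sym (cyclicSum-∷ f e w')) (cyclicSum-pow f e w' k) ⟩
  cyclicSum f (e ∷ w') ℤ.+ + suc k ℤ.* cyclicSum f (e ∷ w')
                                                  ≡⟨ +suc-* (suc k) _ ⟨
  + suc (suc k) ℤ.* cyclicSum f (e ∷ w')          ∎
  where
  open ≡-Reasoning
  P : List Dir
  P = pow (e ∷ w') (suc k)

paritySum : List Dir → ℤ
paritySum []      = 0ℤ
paritySum (x ∷ l) = parity (sideOf x) ℤ.+ paritySum l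

paritySum-++ : ∀ X Y → paritySum (X ++ Y) ≡ paritySum X ℤ.+ paritySum Y
paritySum-++ []      Y = sym (ℤP.+-identityˡ _)
paritySum-++ (x ∷ X) Y =
  trans (cong (ℤ._+_ (parity (sideOf x))) (paritySum-++ X Y)) (sym (ℤP.+-assoc (parity (sideOf x)) (paritySum X) (paritySum Y)))

-- Every inner step is counted twice by the pairs, the two end steps once.
adjacentSum-parity : ∀ x r →
  adjacentSum parityPair (x ∷ r) ≡ + 2 ℤ.* paritySum (x ∷ r) ℤ.- parity (sideOf x) ℤ.- parity (sideOf (last′ x r))
adjacentSum-parity x [] = single (parity (sideOf x))
  where single : ∀ b → 0ℤ ≡ + 2 ℤ.* (b ℤ.+ 0ℤ) ℤ.- b ℤ.- b
        single = solve-∀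
adjacentSum-parity x (y ∷ r) =
  trans (cong (ℤ._+_ (parityPair x y)) (adjacentSum-parity y r))
        (extend (parity (sideOf x)) (parity (sideOf y)) (paritySum r) (parity (sideOf (last′ y r))))
  where extend : ∀ a b S l → a ℤ.+ b ℤ.+ (+ 2 ℤ.* (b ℤ.+ S) ℤ.- b ℤ.- l) ≡ + 2 ℤ.* (a ℤ.+ (b ℤ.+ S)) ℤ.- a ℤ.- l
        extend = solve-∀

halfTurning : List Dir → ℤ
halfTurning w = paritySum w ℤ.+ cyclicSum halfTurn w

cyclicSum-localTurn : ∀ e w' → cyclicSum localTurn (e ∷ w') ≡ + 2 ℤ.* halfTurning (e ∷ w')
cyclicSum-localTurn e w' = begin
  adjacentSum localTurn l
    ≡⟨ adjacentSum-+ parityPair _ l ⟩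
  adjacentSum parityPair l ℤ.+ adjacentSum (λ x y → + 2 ℤ.* halfTurn x y) l
    ≡⟨ cong₂ ℤ._+_ (adjacentSum-parity e (w' ++ e ∷ [])) (adjacentSum-2* halfTurn l) ⟩
  + 2 ℤ.* paritySum l ℤ.- parity (sideOf e) ℤ.- parity (sideOf (last′ e (w' ++ e ∷ []))) ℤ.+ + 2 ℤ.* adjacentSum halfTurn l
    ≡⟨ cong₂ (λ a b → + 2 ℤ.* a ℤ.- parity (sideOf e) ℤ.- parity (sideOf b) ℤ.+ + 2 ℤ.* adjacentSum halfTurn l)
             (paritySum-++ (e ∷ w') (e ∷ [])) (last′-snoc e w' e) ⟩
  + 2 ℤ.* (paritySum (e ∷ w') ℤ.+ (parity (sideOf e) ℤ.+ 0ℤ)) ℤ.- parity (sideOf e) ℤ.- parity (sideOf e) ℤ.+ + 2 ℤ.* adjacentSum halfTurn l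
    ≡⟨ cancel (paritySum (e ∷ w')) (parity (sideOf e)) (adjacentSum halfTurn l) ⟩
  + 2 ℤ.* halfTurning (e ∷ w') ∎
  where
  open ≡-Reasoning
  l : List Dir
  l = (e ∷ w') ++ e ∷ []
  cancel : ∀ S b H → + 2 ℤ.* (S ℤ.+ (b ℤ.+ 0ℤ)) ℤ.- b ℤ.- b ℤ.+ + 2 ℤ.* H ≡ + 2 ℤ.* (S ℤ.+ H)
  cancel = solve-∀

circular-turning : ∀ A D → 3 ≤ length D → Circular A D → Is±2 (cyclicSum localTurn D)
circular-turning A D D≥3 (_ , W , i , _ , R) =
  subst Is±2 totalTurning≡cyclicSum (simpleCurve-turning curve curve-length curve-distinct curve-nonCrossing)
  where open CurveOfPath A D W i R D≥3

4≰2 : ¬ 4 ≤ 2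
4≰2 (s≤s (s≤s ()))

k*2x≢±2 : ∀ k x → 2 ≤ k → ¬ Is±2 (+ k ℤ.* (+ 2 ℤ.* x))
k*2x≢±2 k x k≥2 ±2 = noSolution ∣ x ∣ ∣k*2x∣≡2
  where
  ∣k*2x∣≡2 : k * (2 * ∣ x ∣) ≡ 2
  ∣k*2x∣≡2 = trans (sym (trans (ℤP.abs-* (+ k) (+ 2 ℤ.* x)) (cong (k *_) (ℤP.abs-* (+ 2) x))))
                   (Sum.[ cong ∣_∣ , cong ∣_∣ ] ±2)
  noSolution : ∀ n → k * (2 * n) ≢ 2
  noSolution zero    e with () ← trans (sym (*-zeroʳ k)) e
  noSolution (suc n) e = 4≰2 (≤-trans (*-mono-≤ k≥2 (*-monoʳ-≤ 2 (s≤s (z≤n {n})))) (≤-reflexive e))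

circular⇒length≥2 : ∀ A w → Circular A w → 2 ≤ length w
circular⇒length≥2 A []          (nonEmpty , _) = ⊥-elim (nonEmpty refl)
circular⇒length≥2 A (e ∷ f ∷ w) _              = s≤s (s≤s z≤n)
circular⇒length≥2 A (e ∷ [])    (_ , W , _ , _ , seq , _ , start , end , _ , _ , steps) =
  ⊥-elim (noLoop e (subst (Step A W e (seq Fin.zero)) (trans end (sym start)) (steps Fin.zero)))
  where
  noLoop : ∀ e {i} → Step A W e i i → ⊥
  noLoop right     i≡1+i             = 1+n≢n (sym i≡1+i)
  noLoop left      i≡1+i             = 1+n≢n (sym i≡1+i)
  noLoop (plus s)  (_ , _ , i<i , _) = <-irrefl refl i<i
  noLoop (minus s) (_ , _ , i<i , _) = <-irrefl refl i<i

length-pow : ∀ w k → length (pow w k) ≡ k * length w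
length-pow w zero    = refl
length-pow w (suc k) = trans (length-++ w) (cong (_+_ (length w)) (length-pow w k))

proposition4p5 : (A : Alphabet) (w : List Dir) → Circular A w →
                 (k : ℕ) → 2 ≤ k → ¬ Circular A (pow w k)
proposition4p5 A []       (nonEmpty , _) _ _ _ = nonEmpty refl
proposition4p5 A (e ∷ w') circ (suc k) k≥2 circᵏ =
  k*2x≢±2 (suc k) (halfTurning (e ∷ w')) k≥2 (subst Is±2 turningᵏ (circular-turning A wᵏ length≥3 circᵏ))
  where
  wᵏ : List Dir
  wᵏ = pow (e ∷ w') (suc k)
  length≥3 : 3 ≤ length wᵏ
  length≥3 = subst (3 ≤_) (sym (length-pow (e ∷ w') (suc k)))
                   (≤-trans (n≤1+n 3) (*-mono-≤ k≥2 (circular⇒length≥2 A (e ∷ w') circ)))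
  turningᵏ : cyclicSum localTurn wᵏ ≡ + suc k ℤ.* (+ 2 ℤ.* halfTurning (e ∷ w'))
  turningᵏ = trans (cyclicSum-pow localTurn e w' k) (cong (ℤ._*_ (+ suc k)) (cyclicSum-localTurn e w'))
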